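{- Let $F$ be a ribbon graph, let $\alpha\neq -2,0,1$, $\beta=\alpha(1-\alpha)$ and $\gamma=1/\sqrt{\alpha\beta}$. Then \[ R(F\otimes C_3;\alpha,\beta,\gamma)=(\alpha+2)^{n(F)}\,R\!\left(F;\,\alpha(\alpha+2),\,\frac{\beta}{\alpha+2},\,\gamma\right). \]
   Context: A ribbon graph is a graph with a fixed cyclic order of half-edges at each vertex, regarded as an orientable surface with boundary (vertex discs joined by untwisted edge bands). $v,e,k$ denote numbers of vertices, edges, connected components; $r(H)=v(H)-k(H)$, $n(H)=e(H)-r(H)$; $p(H)$ is the number of boundary components of $H$ as a surface. A state is a spanning sub-ribbon graph (all vertices, a subset of edges); ${\mathcal S}(F)$ is the set of states. Bollobás–Riordan polynomial: $R(F;\alpha,\beta,\gamma)=\sum_{H\in{\mathcal S}(F)}\alpha^{r(F)-r(H)}\beta^{n(H)}\gamma^{k(H)-p(H)+n(H)}$. Tensor product with a cycle: $F\otimes C_p$ is obtained by identifying each edge of $F$ with a distinguished edge of its own copy of the $p$-cycle $C_p$ and then deleting the original edges (a 2-sum with $C_p$ at every edge); equivalently each edge of $F$ is replaced, within its band, by a path of $p-1$ edges through $p-2$ new degree-two vertices. In particular $F\otimes C_3$ is obtained by subdividing every edge of $F$ once. -}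

module Defs where

open import Level using (Level)
open import Data.Nat as ℕ using (ℕ; zero; suc; _∸_; _≤ᵇ_)
open import Data.Fin as Fin using (Fin; toℕ; _↑ˡ_; _↑ʳ_; splitAt)
open import Data.Fin.Properties using () renaming (_≟_ to _≟F_)
open import Data.Bool as Bool using (Bool; true; false; _∧_; _∨_; not; if_then_else_)
open import Data.Vec as Vec using (Vec; []; _∷_; lookup)
open import Data.List as List using (List; []; _∷_; [_]; map; filterᵇ; length; concatMap; allFin; upTo; foldr)
open import Data.Bool.ListAction using (any; all)
open import Data.List.Relation.Binary.Permutation.Propositional using (_↭_)
open import Data.Product using (_×_; _,_)
open import Data.Product.Properties using (≡-dec)
open import Data.Sum using (inj₁; inj₂)
open import Data.Maybe using (Maybe; just; nothing; maybe)
open import Relation.Nullary.Decidable using (⌊_⌋)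
open import Relation.Binary.PropositionalEquality using (_≡_)
open import Relation.Binary.Definitions using (DecidableEquality)
open import Algebra.Bundles using (CommutativeRing)

-- Ribbon graphs (combinatorial rotation systems, all bands untwisted)

-- A half-edge (dart) of edge e is (e , false) or (e , true): the two ends.
Dart : ℕ → Set
Dart n = Fin n × Bool

_≟D_ : ∀ {n} → DecidableEquality (Dart n)
_≟D_ = ≡-dec _≟F_ Bool._≟_

-- Raw ribbon graph: nv vertices, ne edges, and for each vertex the
-- cyclic order (rotation) of the half-edges incident to it, as a list.
record RibbonGraph : Set where
  constructor ribbon
  field
    nv  : ℕ
    ne  : ℕ
    rot : Fin nv → List (Dart ne)
open RibbonGraph public

allDarts : (n : ℕ) → List (Dart n)
allDarts n = concatMap (λ e → (e , false) ∷ (e , true) ∷ []) (allFin n)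

IsRibbonGraph : RibbonGraph → Set
IsRibbonGraph F = concatMap (rot F) (allFin (nv F)) ↭ allDarts (ne F)

-- States: spanning sub-ribbon graphs = subsets of edges

State : RibbonGraph → Set
State F = Vec Bool (ne F)

allSubsets : (n : ℕ) → List (Vec Bool n)
allSubsets zero    = [ [] ]
allSubsets (suc n) = concatMap (λ s → (false ∷ s) ∷ (true ∷ s) ∷ []) (allSubsets n)

states : (F : RibbonGraph) → List (State F)
states F = allSubsets (ne F)

fullState : (F : RibbonGraph) → State F
fullState F = Vec.replicate (ne F) true

countTrue : ∀ {n} → Vec Bool n → ℕ
countTrue []          = 0
countTrue (true ∷ v)  = suc (countTrue v)
countTrue (false ∷ v) = countTrue v

inA : ∀ {n} → Vec Bool n → Dart n → Bool
inA A (e , _) = lookup A e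

firstWith : ∀ {A : Set} → (A → Bool) → List A → Maybe A
firstWith p []       = nothing
firstWith p (x ∷ xs) = if p x then just x else firstWith p xs

memD : ∀ {n} → Dart n → List (Dart n) → Bool
memD h = any (λ x → ⌊ x ≟D h ⌋)

iter : ∀ {A : Set} → (A → A) → ℕ → A → A
iter f zero    x = x
iter f (suc i) x = f (iter f i x)

nextCyc : ∀ {n} → List (Dart n) → Dart n → Dart n
nextCyc []       h = h
nextCyc {n} (x ∷ xs) h = go (x ∷ xs)
  where
  go : List (Dart n) → Dart n
  go []            = x
  go (y ∷ [])      = x
  go (y ∷ z ∷ zs)  = if ⌊ y ≟D h ⌋ then z else go (z ∷ zs)

vertexOf : (F : RibbonGraph) → Dart (ne F) → Maybe (Fin (nv F))
vertexOf F h = firstWith (λ v → memD h (rot F v)) (allFin (nv F))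

rotA : (F : RibbonGraph) → State F → Dart (ne F) → Dart (ne F)
rotA F A h = maybe (λ w → nextCyc (filterᵇ (λ d → inA A d) (rot F w)) h) h (vertexOf F h)

opp : ∀ {n} → Dart n → Dart n
opp (e , b) = (e , not b)

faceStep : (F : RibbonGraph) → State F → Dart (ne F) → Dart (ne F)
faceStep F A h = rotA F A (opp h)

code : ∀ {n} → Dart n → ℕ
code (e , b) = 2 ℕ.* toℕ e ℕ.+ (if b then 1 else 0)

orbitMin : ∀ {n} → (Dart n → Dart n) → Dart n → Bool
orbitMin {n} f h = all (λ i → code h ≤ᵇ code (iter f i h)) (upTo (suc (2 ℕ.* n)))

-- number of boundary components p(H) of the state A:
-- orbits of the face permutation on the darts of A, plus one per isolated vertex
p : (F : RibbonGraph) → State F → ℕ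
p F A =  length (filterᵇ (λ h → inA A h ∧ orbitMin (faceStep F A) h) (allDarts (ne F)))
   ℕ.+ length (filterᵇ (λ v → List.null (filterᵇ (λ d → inA A d) (rot F v))) (allFin (nv F)))

at : (F : RibbonGraph) → Dart (ne F) → Fin (nv F) → Bool
at F h w = maybe (λ v → ⌊ v ≟F w ⌋) false (vertexOf F h)

adj : (F : RibbonGraph) → State F → Fin (nv F) → Fin (nv F) → Bool
adj F A u w = any (λ e → lookup A e ∧
                  ((at F (e , false) u ∧ at F (e , true) w) ∨ (at F (e , true) u ∧ at F (e , false) w)))
                (allFin (ne F))

reach : (F : RibbonGraph) → State F → Fin (nv F) → Fin (nv F) → Bool
reach F A v = iter step (nv F) (λ w → ⌊ v ≟F w ⌋)
  where
  step : (Fin (nv F) → Bool) → Fin (nv F) → Bool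
  step S w = S w ∨ any (λ u → S u ∧ adj F A u w) (allFin (nv F))

-- number of connected components k(H): vertices least in their component
k : (F : RibbonGraph) → State F → ℕ
k F A = length (filterᵇ (λ v → all (λ w → not (reach F A v w) ∨ (toℕ v ≤ᵇ toℕ w)) (allFin (nv F)))
                       (allFin (nv F)))

e : (F : RibbonGraph) → State F → ℕ
e F A = countTrue A

r : (F : RibbonGraph) → State F → ℕ
r F A = nv F ∸ k F A

n : (F : RibbonGraph) → State F → ℕ
n F A = (e F A ℕ.+ k F A) ∸ nv F

nG : RibbonGraph → ℕ
nG F = n F (fullState F)

rG : RibbonGraph → ℕ
rG F = r F (fullState F)

-- Bollobás–Riordan polynomial, evaluated in a commutative ring

module _ {c ℓ : Level} (K : CommutativeRing c ℓ) where
  open CommutativeRing K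

  pow : Carrier → ℕ → Carrier
  pow x zero    = 1#
  pow x (suc m) = x * pow x m

  BR : RibbonGraph → Carrier → Carrier → Carrier → Carrier
  BR F α β γ = foldr _+_ 0# (map term (states F))
    where
    term : State F → Carrier
    term A = pow α (rG F ∸ r F A) * pow β (n F A)
             * pow γ ((k F A ℕ.+ n F A) ∸ p F A)

  IsFieldCR : Set (c Level.⊔ ℓ)
  IsFieldCR = (0# ≈ 1# → Data.Empty.⊥)
            × (∀ x → (x ≈ 0# → Data.Empty.⊥) → Data.Product.∃ λ y → x * y ≈ 1#)
    where import Data.Empty; import Data.Product

-- Tensor product with C₃ = subdivide every edge once.
-- Edge e of F becomes edges  e ↑ˡ ne  (from the (e,false) end to the
-- new vertex nv ↑ʳ e) and  ne ↑ʳ e  (from the new vertex to the (e,true) end).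

tensorC3 : RibbonGraph → RibbonGraph
tensorC3 (ribbon V E ρ) = ribbon (V ℕ.+ E) (E ℕ.+ E) ρ'
  where
  relabel : Dart E → Dart (E ℕ.+ E)
  relabel (e , false) = (e ↑ˡ E , false)
  relabel (e , true)  = (E ↑ʳ e , true)
  ρ' : Fin (V ℕ.+ E) → List (Dart (E ℕ.+ E))
  ρ' v with splitAt V v
  ... | inj₁ u = map relabel (ρ u)
  ... | inj₂ e = (e ↑ˡ E , true) ∷ (E ↑ʳ e , false) ∷ []

module Submission where

-- A state of F ⊗ C₃ is a pair s₁ , s₂ of edge sets recording which halves of the
-- subdivided edges are kept; it induces the state A = s₁ ∧ s₂ of F.  An edge with one
-- half kept is a pendant edge and changes neither the components nor the boundary
-- of A, while an edge with no half kept leaves an isolated new vertex, adding one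
-- component and one boundary component.  So k and p both grow by the number of such
-- edges, the nullity is that of A, and the state contributes the weight of A times
-- α for each of them.  Summing over the three ways of leaving out an edge of A gives
-- a factor α + 2 per edge outside A, which is redistributed as (α + 2)^n(F) and the
-- rescaled variables α (α + 2) and β / (α + 2).

open import Defs
open import Level using (Level)
open import Algebra.Bundles using (CommutativeRing)
open import Relation.Nullary using (¬_)

module Combinatorics where

  open import Data.Nat as ℕ using (ℕ; zero; suc; _+_; _*_; _∸_; _≤_; _<_; z≤n; s≤s; _≤ᵇ_)
  open import Data.Nat.Properties
  open import Data.Nat.DivMod using (_%_; _/_; m≡m%n+[m/n]*n; m%n<n)
  open import Data.Bool as Bool using (Bool; true; false; _∧_; _∨_; not; T; if_then_else_)
  open import Data.Bool.Properties using (∨-zeroʳ; ¬-not; if-float; T-≡)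
  open import Data.Bool.ListAction using (any; all)
  open import Data.List as List using (List; []; _∷_; [_]; length; filterᵇ; map; _++_; allFin; upTo; concatMap; tabulate; null)
  open import Data.List.Properties using (length-tabulate; length-map; map-tabulate; map-cong; ++-assoc; length-++; ++-identityʳ; ∷-injective; filter-++; length-filter)
  open import Data.List.Membership.Propositional using (_∈_; _∉_; find; lose)
  open import Data.List.Membership.Propositional.Properties using (∈-allFin; ∈-++⁺ˡ; ∈-++⁺ʳ; ∈-++⁻; ∈-∃++; ∈-map⁺; ∈-map⁻; ∈-upTo⁺; ∈-concatMap⁺; ∈-concatMap⁻; ∈-filter⁻; ∈-filter⁺)
  import Data.List.Membership.DecPropositional as DecMembership
  open import Data.List.Relation.Unary.Any using (here; there)
  open import Data.List.Relation.Unary.All as All using (All; []; _∷_)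
  open import Data.List.Relation.Unary.All.Properties using (++⁻ˡ; ++⁻ʳ; All¬⇒¬Any) renaming (++⁺ to All-++⁺)
  open import Data.List.Relation.Unary.Unique.Propositional using (Unique; []; _∷_)
  open import Data.List.Relation.Unary.Unique.Propositional.Properties using (allFin⁺; filter⁺) renaming (++⁺ to Unique-++⁺; map⁺ to Unique-map⁺)
  open import Data.List.Relation.Binary.Permutation.Propositional using (_↭_; ↭-sym; ↭⇒↭ₛ′)
  open import Data.List.Relation.Binary.Permutation.Propositional.Properties using (∈-resp-↭)
  open import Data.List.Relation.Binary.Permutation.Setoid.Properties using (Unique-resp-↭)
  open import Data.Fin as Fin using (Fin; toℕ; _↑ˡ_; _↑ʳ_; splitAt)
  open import Data.Fin.Properties using (toℕ-injective; toℕ<n; toℕ-↑ˡ; toℕ-↑ʳ; ↑ˡ-injective; ↑ʳ-injective; splitAt-↑ˡ; splitAt-↑ʳ; pigeonhole; toℕ-combine; combine-injective) renaming (_≟_ to _≟F_)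
  open import Data.Vec as Vec using (Vec; []; _∷_; lookup; zipWith; replicate) renaming (_++_ to _++ᵛ_)
  open import Data.Vec.Properties using (lookup-++ˡ; lookup-++ʳ; lookup-zipWith; lookup∘updateAt′; []≔-idempotent; []≔-lookup; zipWith-replicate; lookup-replicate)
  open import Data.Maybe using (just; nothing; fromMaybe; maybe)
  open import Data.Maybe.Properties using (just-injective)
  open import Data.Product using (Σ; _×_; _,_; proj₁; proj₂; ∃)
  open import Data.Sum using (_⊎_; inj₁; inj₂) renaming (map to ⊎-map)
  open import Data.Sum.Properties using (inj₁-injective; inj₂-injective) renaming (≡-dec to ⊎-≡-dec)
  open import Data.Empty using (⊥; ⊥-elim)
  open import Function using (_∘_; case_of_)
  open import Function.Bundles using (module Equivalence)
  open import Relation.Binary.Definitions using (DecidableEquality)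
  open import Relation.Binary.PropositionalEquality hiding ([_])
  open import Relation.Binary.PropositionalEquality.Properties using (setoid; isEquivalence)
  open import Relation.Binary.Construct.Closure.ReflexiveTransitive using (Star; ε; _◅_; _◅◅_) renaming (reverse to Star-reverse; map to Star-map)
  open import Relation.Nullary using (¬_; yes; no)
  open import Relation.Nullary.Decidable using (⌊_⌋)

  -- Lists and counting

  count : {A : Set} → (A → Bool) → List A → ℕ
  count p xs = length (filterᵇ p xs)

  module _ {A : Set} where

    count-cong : (p q : A → Bool) (xs : List A) → (∀ x → x ∈ xs → p x ≡ q x) → count p xs ≡ count q xs
    count-cong p q [] eq = refl
    count-cong p q (x ∷ xs) eq with p x | q x | eq x (here refl)
    ... | true  | true  | _ = cong suc (count-cong p q xs (λ y m → eq y (there m)))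
    ... | false | false | _ = count-cong p q xs (λ y m → eq y (there m))

    count-mono : (p q : A → Bool) (xs : List A) → (∀ x → x ∈ xs → p x ≡ true → q x ≡ true) →
                 count p xs ≤ count q xs
    count-mono p q [] sub = z≤n
    count-mono p q (x ∷ xs) sub with p x | q x | sub x (here refl)
    ... | true  | true  | _ = s≤s (count-mono p q xs (λ y m → sub y (there m)))
    ... | true  | false | r with () ← r refl
    ... | false | true  | _ = m≤n⇒m≤1+n (count-mono p q xs (λ y m → sub y (there m)))
    ... | false | false | _ = count-mono p q xs (λ y m → sub y (there m))

    count-mono-< : (p q : A → Bool) (xs : List A) → (∀ x → x ∈ xs → p x ≡ true → q x ≡ true) →
                   ∀ z → z ∈ xs → p z ≡ false → q z ≡ true → count p xs < count q xs
    count-mono-< p q (x ∷ xs) sub z (here refl) pz qz rewrite pz | qz =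
      s≤s (count-mono p q xs (λ y m → sub y (there m)))
    count-mono-< p q (x ∷ xs) sub z (there z∈xs) pz qz with p x | q x | sub x (here refl)
    ... | true  | true  | _ = s≤s (count-mono-< p q xs (λ y m → sub y (there m)) z z∈xs pz qz)
    ... | true  | false | r with () ← r refl
    ... | false | true  | _ = m≤n⇒m≤1+n (count-mono-< p q xs (λ y m → sub y (there m)) z z∈xs pz qz)
    ... | false | false | _ = count-mono-< p q xs (λ y m → sub y (there m)) z z∈xs pz qz

    count≤length : (p : A → Bool) (xs : List A) → count p xs ≤ length xs
    count≤length p xs = length-filter (Bool.T? ∘ p) xs

    count-all : (p : A → Bool) (xs : List A) → (∀ x → x ∈ xs → p x ≡ true) → count p xs ≡ length xs
    count-all p [] all-p = refl
    count-all p (x ∷ xs) all-p with p x | all-p x (here refl)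
    ... | true | _ = cong suc (count-all p xs (λ y m → all-p y (there m)))

    count-++ : (p : A → Bool) (xs ys : List A) → count p (xs ++ ys) ≡ count p xs + count p ys
    count-++ p [] ys = refl
    count-++ p (x ∷ xs) ys with p x
    ... | true  = cong suc (count-++ p xs ys)
    ... | false = count-++ p xs ys

    count≤1+count : (p q : A → Bool) (xs : List A) → Unique xs →
                    (∀ v v' → p v ≡ true → q v ≡ false → p v' ≡ true → q v' ≡ false → v ≡ v') →
                    count p xs ≤ suc (count q xs)
    count≤1+count p q [] u lost≤1 = z≤n
    count≤1+count p q (x ∷ xs) (x∉xs ∷ u) lost≤1 with p x in px | q x in qx
    ... | true  | true  = s≤s (count≤1+count p q xs u lost≤1)
    ... | false | true  = m≤n⇒m≤1+n (count≤1+count p q xs u lost≤1)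
    ... | false | false = count≤1+count p q xs u lost≤1
    ... | true  | false = s≤s (count-mono p q xs kept)
      where
      kept : ∀ y → y ∈ xs → p y ≡ true → q y ≡ true
      kept y y∈xs py with q y in qy
      ... | true  = refl
      ... | false = ⊥-elim (All.lookup x∉xs y∈xs (lost≤1 x y px qx py qy))

  count-map : {A B : Set} (f : A → B) (p : B → Bool) (xs : List A) → count p (map f xs) ≡ count (p ∘ f) xs
  count-map f p [] = refl
  count-map f p (x ∷ xs) with p (f x)
  ... | true  = cong suc (count-map f p xs)
  ... | false = count-map f p xs

  tabulate-+ : {A : Set} (m n : ℕ) (f : Fin (m + n) → A) →
               tabulate f ≡ tabulate (λ i → f (i ↑ˡ n)) ++ tabulate (λ j → f (m ↑ʳ j))
  tabulate-+ zero    n f = refl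
  tabulate-+ (suc m) n f = cong (f Fin.zero ∷_) (tabulate-+ m n (λ i → f (Fin.suc i)))

  count-allFin-+ : (m n : ℕ) (p : Fin (m + n) → Bool) →
    count p (allFin (m + n)) ≡ count (λ i → p (i ↑ˡ n)) (allFin m) + count (λ j → p (m ↑ʳ j)) (allFin n)
  count-allFin-+ m n p = begin
    count p (allFin (m + n))                                         ≡⟨ cong (count p) (allFin-+ m n) ⟩
    count p (tabulate (_↑ˡ n) ++ tabulate (m ↑ʳ_))                   ≡⟨ count-++ p (tabulate (_↑ˡ n)) (tabulate (m ↑ʳ_)) ⟩
    count p (tabulate (_↑ˡ n)) + count p (tabulate (m ↑ʳ_))          ≡⟨ cong₂ _+_ (cong (count p) (sym (map-tabulate (λ i → i) (_↑ˡ n))))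
                                                                                  (cong (count p) (sym (map-tabulate (λ i → i) (m ↑ʳ_)))) ⟩
    count p (map (_↑ˡ n) (allFin m)) + count p (map (m ↑ʳ_) (allFin n)) ≡⟨ cong₂ _+_ (count-map (_↑ˡ n) p (allFin m)) (count-map (m ↑ʳ_) p (allFin n)) ⟩
    count (λ i → p (i ↑ˡ n)) (allFin m) + count (λ j → p (m ↑ʳ j)) (allFin n) ∎
    where
    open ≡-Reasoning
    allFin-+ : ∀ m n → allFin (m + n) ≡ tabulate (_↑ˡ n) ++ tabulate (m ↑ʳ_)
    allFin-+ m n = tabulate-+ m n (λ i → i)

  count-suc : ∀ {n} (p : Fin (suc n) → Bool) → count p (tabulate Fin.suc) ≡ count (p ∘ Fin.suc) (allFin n)
  count-suc p = trans (cong (count p) (sym (map-tabulate (λ i → i) Fin.suc))) (count-map Fin.suc p (allFin _))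

  count-lookup : ∀ {n} (v : Vec Bool n) → count (lookup v) (allFin n) ≡ countTrue v
  count-lookup []          = refl
  count-lookup (true ∷ v)  = cong suc (trans (count-suc (lookup (true ∷ v))) (count-lookup v))
  count-lookup (false ∷ v) = trans (count-suc (lookup (false ∷ v))) (count-lookup v)

  ∈-filterᵇ⁻ : {A : Set} (p : A → Bool) (xs : List A) {x : A} → x ∈ filterᵇ p xs → x ∈ xs × p x ≡ true
  ∈-filterᵇ⁻ p xs x∈ with ∈-filter⁻ (Bool.T? ∘ p) x∈
  ... | x∈xs , px = x∈xs , Equivalence.to T-≡ px

  ∈-filterᵇ⁺ : {A : Set} (p : A → Bool) {xs : List A} {x : A} → x ∈ xs → p x ≡ true → x ∈ filterᵇ p xs
  ∈-filterᵇ⁺ p x∈ px = ∈-filter⁺ (Bool.T? ∘ p) x∈ (Equivalence.from T-≡ px)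

  module _ {A : Set} where

    any⁻ : (p : A → Bool) (xs : List A) → any p xs ≡ true → ∃ λ x → x ∈ xs × p x ≡ true
    any⁻ p (x ∷ xs) h with p x in px
    ... | true  = x , here refl , px
    ... | false = let (y , y∈xs , py) = any⁻ p xs h in y , there y∈xs , py

    any⁺ : (p : A → Bool) (xs : List A) (x : A) → x ∈ xs → p x ≡ true → any p xs ≡ true
    any⁺ p (y ∷ xs) x (here refl) px rewrite px = refl
    any⁺ p (y ∷ xs) x (there x∈xs) px rewrite any⁺ p xs x x∈xs px = ∨-zeroʳ (p y)

    all⁻ : (p : A → Bool) (xs : List A) → all p xs ≡ true → ∀ x → x ∈ xs → p x ≡ true
    all⁻ p (y ∷ xs) h x x∈ with p y in py
    all⁻ p (y ∷ xs) h x (here refl)  | true = py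
    all⁻ p (y ∷ xs) h x (there x∈xs) | true = all⁻ p xs h x x∈xs

    all⁺ : (p : A → Bool) (xs : List A) → (∀ x → x ∈ xs → p x ≡ true) → all p xs ≡ true
    all⁺ p []       h = refl
    all⁺ p (y ∷ xs) h rewrite h y (here refl) = all⁺ p xs (λ x m → h x (there m))

    all-false⁻ : (p : A → Bool) (xs : List A) → all p xs ≡ false → ∃ λ x → x ∈ xs × p x ≡ false
    all-false⁻ p (y ∷ xs) h with p y in py
    ... | false = y , here refl , py
    ... | true  = let (z , z∈xs , pz) = all-false⁻ p xs h in z , there z∈xs , pz

  ∨≡true⁻ : ∀ a b → a ∨ b ≡ true → a ≡ true ⊎ b ≡ true
  ∨≡true⁻ true  b h = inj₁ refl
  ∨≡true⁻ false b h = inj₂ h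

  ∧≡true⁻ : ∀ a b → a ∧ b ≡ true → a ≡ true × b ≡ true
  ∧≡true⁻ true true h = refl , refl

  ≤ᵇ≡true⁻ : ∀ m n → (m ≤ᵇ n) ≡ true → m ≤ n
  ≤ᵇ≡true⁻ m n h = ≤ᵇ⇒≤ m n (subst T (sym h) _)

  ≤ᵇ≡true⁺ : ∀ m n → m ≤ n → (m ≤ᵇ n) ≡ true
  ≤ᵇ≡true⁺ m n h with m ≤ᵇ n in eq
  ... | true  = refl
  ... | false = ⊥-elim (subst T eq (≤⇒≤ᵇ h))

  isYes⇒≡ : {A : Set} (_≟_ : DecidableEquality A) (x y : A) → ⌊ x ≟ y ⌋ ≡ true → x ≡ y
  isYes⇒≡ _≟_ x y h with x ≟ y
  ... | yes x≡y = x≡y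

  ≡⇒isYes : {A : Set} (_≟_ : DecidableEquality A) {x y : A} → x ≡ y → ⌊ x ≟ y ⌋ ≡ true
  ≡⇒isYes _≟_ x≡y = cong ⌊_⌋ (≡-≟-identity _≟_ x≡y)

  ≢⇒isNo : {A : Set} (_≟_ : DecidableEquality A) {x y : A} → ¬ x ≡ y → ⌊ x ≟ y ⌋ ≡ false
  ≢⇒isNo _≟_ x≢y = cong ⌊_⌋ (≢-≟-identity _≟_ x≢y)

  module _ {n : ℕ} (h : Dart n) where

    memD-true⁻ : ∀ L → memD h L ≡ true → h ∈ L
    memD-true⁻ (x ∷ L) eq with x ≟D h
    ... | yes refl = here refl
    ... | no _     = there (memD-true⁻ L eq)

    memD-true⁺ : ∀ {L} → h ∈ L → memD h L ≡ true
    memD-true⁺ {x ∷ L} (here refl) rewrite ≡⇒isYes _≟D_ {h} refl = refl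
    memD-true⁺ {x ∷ L} (there h∈L) with x ≟D h
    ... | yes _ = refl
    ... | no _  = memD-true⁺ h∈L

  module _ {A : Set} (p : A → Bool) where

    firstWith-just⁻ : ∀ xs {y} → firstWith p xs ≡ just y → y ∈ xs × p y ≡ true
    firstWith-just⁻ (x ∷ xs) eq with p x in px
    firstWith-just⁻ (x ∷ xs) refl | true = here refl , px
    ... | false = let (y∈xs , py) = firstWith-just⁻ xs eq in there y∈xs , py

    firstWith-just⁺ : ∀ {xs x} → x ∈ xs → p x ≡ true → ∃ λ y → firstWith p xs ≡ just y
    firstWith-just⁺ {z ∷ xs} x∈ px with p z in pz
    ... | true = z , refl
    firstWith-just⁺ {z ∷ xs} (here refl) px | false with () ← trans (sym px) pz
    firstWith-just⁺ {z ∷ xs} (there x∈xs) px | false = firstWith-just⁺ x∈xs px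

    firstWith-unique : ∀ {xs x} → x ∈ xs → p x ≡ true → (∀ y → y ∈ xs → p y ≡ true → y ≡ x) → firstWith p xs ≡ just x
    firstWith-unique {z ∷ xs} x∈ px only-x with p z in pz
    ... | true = cong just (only-x z (here refl) pz)
    firstWith-unique {z ∷ xs} (here refl) px only-x | false with () ← trans (sym px) pz
    firstWith-unique {z ∷ xs} (there x∈xs) px only-x | false = firstWith-unique x∈xs px (λ y y∈ → only-x y (there y∈))

  module _ {A : Set} where

    Unique-++⁻ˡ : ∀ xs {ys : List A} → Unique (xs ++ ys) → Unique xs
    Unique-++⁻ˡ []       u        = []
    Unique-++⁻ˡ (x ∷ xs) (x∉ ∷ u) = ++⁻ˡ xs x∉ ∷ Unique-++⁻ˡ xs u

    Unique-++⁻ʳ : ∀ xs {ys : List A} → Unique (xs ++ ys) → Unique ys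
    Unique-++⁻ʳ []       u       = u
    Unique-++⁻ʳ (x ∷ xs) (_ ∷ u) = Unique-++⁻ʳ xs u

    Unique-++-disjoint : ∀ xs {ys : List A} {z} → Unique (xs ++ ys) → z ∈ xs → z ∈ ys → ⊥
    Unique-++-disjoint (x ∷ xs) (x∉ ∷ u) (here refl) z∈ys = All¬⇒¬Any (++⁻ʳ xs x∉) z∈ys
    Unique-++-disjoint (x ∷ xs) (_ ∷ u)  (there z∈) z∈ys = Unique-++-disjoint xs u z∈ z∈ys

    Unique-↭ : {xs ys : List A} → xs ↭ ys → Unique xs → Unique ys
    Unique-↭ xs↭ys = Unique-resp-↭ (setoid A) (↭⇒↭ₛ′ (isEquivalence) xs↭ys)

  module _ {A B : Set} (f : A → List B) where

    ∈-concatMap⁻′ : ∀ xs {y} → y ∈ concatMap f xs → ∃ λ x → x ∈ xs × y ∈ f x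
    ∈-concatMap⁻′ xs y∈ = find (∈-concatMap⁻ f y∈)

    Unique-concatMap⁻ : ∀ xs → Unique (concatMap f xs) → ∀ {x} → x ∈ xs → Unique (f x)
    Unique-concatMap⁻ (x ∷ xs) u (here refl) = Unique-++⁻ˡ (f x) u
    Unique-concatMap⁻ (x ∷ xs) u (there x∈) = Unique-concatMap⁻ xs (Unique-++⁻ʳ (f x) u) x∈

    concatMap-disjoint : ∀ xs → Unique (concatMap f xs) → ∀ {x x' y} → x ∈ xs → x' ∈ xs → y ∈ f x → y ∈ f x' → x ≡ x'
    concatMap-disjoint (z ∷ xs) u (here refl) (here refl) _ _ = refl
    concatMap-disjoint (z ∷ xs) u (here refl) (there x'∈) y∈ y∈' =
      ⊥-elim (Unique-++-disjoint (f z) u y∈ (∈-concatMap⁺ f (lose x'∈ y∈')))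
    concatMap-disjoint (z ∷ xs) u (there x∈) (here refl) y∈ y∈' =
      ⊥-elim (Unique-++-disjoint (f z) u y∈' (∈-concatMap⁺ f (lose x∈ y∈)))
    concatMap-disjoint (z ∷ xs) u (there x∈) (there x'∈) y∈ y∈' =
      concatMap-disjoint xs (Unique-++⁻ʳ (f z) u) x∈ x'∈ y∈ y∈'

  -- Well-formed ribbon graphs

  dartsOf : ∀ {n} → Fin n → List (Dart n)
  dartsOf e = (e , false) ∷ (e , true) ∷ []

  ∈-allDarts : ∀ {n} (h : Dart n) → h ∈ allDarts n
  ∈-allDarts (e , false) = ∈-concatMap⁺ dartsOf (lose (∈-allFin e) (here refl))
  ∈-allDarts (e , true)  = ∈-concatMap⁺ dartsOf (lose (∈-allFin e) (there (here refl)))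

  Unique-allDarts : ∀ n → Unique (allDarts n)
  Unique-allDarts n = go (allFin n) (allFin⁺ n)
    where
    edge∈ : ∀ {x b xs} → (x , b) ∈ concatMap dartsOf xs → x ∈ xs
    edge∈ {xs = xs} m with ∈-concatMap⁻′ dartsOf xs m
    ... | _ , x∈ , here refl = x∈
    ... | _ , x∈ , there (here refl) = x∈
    go : ∀ xs → Unique xs → Unique (concatMap dartsOf xs)
    go []       []        = []
    go (x ∷ xs) (x∉ ∷ u) =
      ((λ ()) ∷ All.tabulate (fresh false)) ∷ All.tabulate (fresh true) ∷ go xs u
      where
      fresh : ∀ b {y} → y ∈ concatMap dartsOf xs → ¬ (x , b) ≡ y
      fresh b y∈ refl = All¬⇒¬Any x∉ (edge∈ y∈)

  record WellFormed (F : RibbonGraph) : Set where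
    field
      vertex       : Dart (ne F) → Fin (nv F)
      vertexOf≡    : ∀ h → vertexOf F h ≡ just (vertex h)
      ∈-rot        : ∀ h → h ∈ rot F (vertex h)
      rot-unique   : ∀ u → Unique (rot F u)
      ∈-rot⇒vertex : ∀ u h → h ∈ rot F u → vertex h ≡ u

    at≡ : ∀ h w → at F h w ≡ ⌊ vertex h ≟F w ⌋
    at≡ h w rewrite vertexOf≡ h = refl

  wellFormed : (F : RibbonGraph) → IsRibbonGraph F → WellFormed F
  wellFormed F isRG = record
    { vertex       = λ h → proj₁ (located h)
    ; vertexOf≡    = λ h → proj₁ (proj₂ (located h))
    ; ∈-rot        = λ h → proj₂ (proj₂ (located h))
    ; rot-unique   = λ u → Unique-concatMap⁻ (rot F) (allFin (nv F)) unique (∈-allFin u)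
    ; ∈-rot⇒vertex = λ u h h∈ → concatMap-disjoint (rot F) (allFin (nv F)) unique
                                   (∈-allFin _) (∈-allFin u) (proj₂ (proj₂ (located h))) h∈
    }
    where
    unique : Unique (concatMap (rot F) (allFin (nv F)))
    unique = Unique-↭ (↭-sym isRG) (Unique-allDarts (ne F))

    located : ∀ h → ∃ λ u → vertexOf F h ≡ just u × h ∈ rot F u
    located h with ∈-concatMap⁻′ (rot F) (allFin (nv F)) (∈-resp-↭ (↭-sym isRG) (∈-allDarts h))
    ... | u , _ , h∈ with firstWith-just⁺ (λ v → memD h (rot F v)) (∈-allFin u) (memD-true⁺ h h∈)
    ... | w , eq = w , eq , memD-true⁻ h (rot F w) (proj₂ (firstWith-just⁻ _ (allFin (nv F)) eq))

  -- Reachability and connected components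

  module Closure (N : ℕ) (adjacent : Fin N → Fin N → Bool) where

    record Edge (u w : Fin N) : Set where
      constructor edge
      field adjacent≡true : adjacent u w ≡ true

    Path : Fin N → Fin N → Set
    Path = Star Edge

    expand : (Fin N → Bool) → Fin N → Bool
    expand S w = S w ∨ any (λ u → S u ∧ adjacent u w) (allFin N)

    reachIn : ℕ → Fin N → Fin N → Bool
    reachIn i v = iter expand i (λ w → ⌊ v ≟F w ⌋)

    reachIn-sound : ∀ i v w → reachIn i v w ≡ true → Path v w
    reachIn-sound zero v w h rewrite isYes⇒≡ _≟F_ v w h = ε
    reachIn-sound (suc i) v w h with ∨≡true⁻ (reachIn i v w) _ h
    ... | inj₁ old = reachIn-sound i v w old
    ... | inj₂ new with any⁻ _ (allFin N) new
    ... | u , _ , vu∧uw with ∧≡true⁻ (reachIn i v u) _ vu∧uw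
    ... | vu , uw = reachIn-sound i v u vu ◅◅ (edge uw ◅ ε)

    expand-⊇ : ∀ S w → S w ≡ true → expand S w ≡ true
    expand-⊇ S w h rewrite h = refl

    Closed : (Fin N → Bool) → Set
    Closed S = ∀ w → expand S w ≡ true → S w ≡ true

    closed? : (S : Fin N → Bool) → Closed S ⊎ ∃ λ w → expand S w ≡ true × S w ≡ false
    closed? S with all (λ w → not (expand S w) ∨ S w) (allFin N) in eq
    ... | true = inj₁ λ w h → implied (all⁻ _ (allFin N) eq w (∈-allFin w)) h
      where
      implied : ∀ {a b} → not a ∨ b ≡ true → a ≡ true → b ≡ true
      implied h refl = h
    ... | false with all-false⁻ _ (allFin N) eq
    ... | w , _ , h = inj₂ (w , refuted (expand S w) (S w) h)
      where
      refuted : ∀ a b → not a ∨ b ≡ false → a ≡ true × b ≡ false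
      refuted true false _ = refl , refl

    expand-cong : ∀ S S' → (∀ u → S u ≡ S' u) → ∀ w → expand S w ≡ expand S' w
    expand-cong S S' eq w rewrite eq w = cong (S' w ∨_) (any-cong (allFin N))
      where
      any-cong : ∀ xs → any (λ u → S u ∧ adjacent u w) xs ≡ any (λ u → S' u ∧ adjacent u w) xs
      any-cong []       = refl
      any-cong (x ∷ xs) rewrite eq x | any-cong xs = refl

    closed⇒fixed : ∀ S → Closed S → ∀ w → expand S w ≡ S w
    closed⇒fixed S closed w with expand S w in ew
    ... | true  = sym (closed w ew)
    ... | false = sym (¬-not λ sw → case trans (sym ew) (expand-⊇ S w sw) of λ ())

    -- Each round either adds a vertex or has reached a closed set, so N rounds suffice.
    stabilises : ∀ i v → Closed (reachIn i v) ⊎ suc i ≤ count (reachIn i v) (allFin N)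
    stabilises zero v = inj₂ (≤-trans (s≤s z≤n) (count-mono-< (λ _ → false) (reachIn zero v) (allFin N) (λ _ _ ()) v (∈-allFin v) refl
                                                             (≡⇒isYes _≟F_ refl)))
    stabilises (suc i) v with closed? (reachIn i v)
    ... | inj₁ closed = inj₁ λ w h → trans (closed⇒fixed (reachIn i v) closed w)
            (closed w (trans (expand-cong (reachIn i v) (reachIn (suc i) v) (λ u → sym (closed⇒fixed (reachIn i v) closed u)) w) h))
    ... | inj₂ (w , grows , new) with stabilises i v
    ... | inj₁ closed with () ← trans (sym (closed w grows)) new
    ... | inj₂ big = inj₂ (≤-trans (s≤s big)
            (count-mono-< (reachIn i v) (reachIn (suc i) v) (allFin N) (λ x _ → expand-⊇ (reachIn i v) x) w (∈-allFin w) new grows))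

    reachIn-closed : ∀ v → Closed (reachIn N v)
    reachIn-closed v with stabilises N v
    ... | inj₁ closed = closed
    ... | inj₂ big = ⊥-elim (<⇒≱ big (subst (count (reachIn N v) (allFin N) ≤_) (length-tabulate (λ i → i))
                                            (count≤length (reachIn N v) (allFin N))))

    reachIn-start : ∀ i v → reachIn i v v ≡ true
    reachIn-start zero    v = ≡⇒isYes _≟F_ refl
    reachIn-start (suc i) v = expand-⊇ (reachIn i v) v (reachIn-start i v)

    reachIn-complete : ∀ v w → Path v w → reachIn N v w ≡ true
    reachIn-complete v w path = go path (reachIn-start N v)
      where
      go : ∀ {u w} → Path u w → reachIn N v u ≡ true → reachIn N v w ≡ true
      go ε          h = h
      go (edge uj ◅ path) h = go path (reachIn-closed v _ (trans (cong (reachIn N v _ ∨_)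
                           (any⁺ _ (allFin N) _ (∈-allFin _) (cong₂ _∧_ h uj))) (∨-zeroʳ _)))

  countTrue≡0⁻ : ∀ {n} (A : Vec Bool n) → countTrue A ≡ 0 → ∀ i → lookup A i ≡ false
  countTrue≡0⁻ (false ∷ A) h Fin.zero    = refl
  countTrue≡0⁻ (false ∷ A) h (Fin.suc i) = countTrue≡0⁻ A h i

  countTrue≡suc⁻ : ∀ {n} (A : Vec Bool n) {j} → countTrue A ≡ suc j → ∃ λ i → lookup A i ≡ true
  countTrue≡suc⁻ (true ∷ A)  h = Fin.zero , refl
  countTrue≡suc⁻ (false ∷ A) h = let (i , Ai) = countTrue≡suc⁻ A h in Fin.suc i , Ai

  countTrue-clear : ∀ {n} (A : Vec Bool n) i → lookup A i ≡ true → suc (countTrue (A Vec.[ i ]≔ false)) ≡ countTrue A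
  countTrue-clear (true ∷ A)  Fin.zero    refl = refl
  countTrue-clear (true ∷ A)  (Fin.suc i) Ai   = cong suc (countTrue-clear A i Ai)
  countTrue-clear (false ∷ A) (Fin.suc i) Ai   = countTrue-clear A i Ai

  module Components (F : RibbonGraph) (W : WellFormed F) where
    open WellFormed W

    Joins : Fin (ne F) → Fin (nv F) → Fin (nv F) → Set
    Joins e u w = (vertex (e , false) ≡ u × vertex (e , true) ≡ w) ⊎ (vertex (e , true) ≡ u × vertex (e , false) ≡ w)

    Joins-sym : ∀ {e u w} → Joins e u w → Joins e w u
    Joins-sym (inj₁ (a , b)) = inj₂ (b , a)
    Joins-sym (inj₂ (a , b)) = inj₁ (b , a)

    adj-true⁻ : ∀ A u w → adj F A u w ≡ true → ∃ λ e → lookup A e ≡ true × Joins e u w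
    adj-true⁻ A u w h with any⁻ _ (allFin (ne F)) h
    ... | e , _ , q with ∧≡true⁻ (lookup A e) _ q
    ... | Ae , ends rewrite at≡ (e , false) u | at≡ (e , true) w | at≡ (e , true) u | at≡ (e , false) w =
      e , Ae , ⊎-map both both (∨≡true⁻ _ _ ends)
      where
      both : ∀ {a b c d} → ⌊ a ≟F c ⌋ ∧ ⌊ b ≟F d ⌋ ≡ true → a ≡ c × b ≡ d
      both q = isYes⇒≡ _≟F_ _ _ (proj₁ (∧≡true⁻ _ _ q)) , isYes⇒≡ _≟F_ _ _ (proj₂ (∧≡true⁻ _ _ q))

    adj-true⁺ : ∀ A u w e → lookup A e ≡ true → Joins e u w → adj F A u w ≡ true
    adj-true⁺ A u w e Ae joins = any⁺ _ (allFin (ne F)) e (∈-allFin e) (cong₂ _∧_ Ae (ends joins))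
      where
      ends : Joins e u w → (at F (e , false) u ∧ at F (e , true) w) ∨ (at F (e , true) u ∧ at F (e , false) w) ≡ true
      ends (inj₁ (refl , refl)) rewrite at≡ (e , false) (vertex (e , false)) | at≡ (e , true) (vertex (e , true))
        | ≡⇒isYes _≟F_ {vertex (e , false)} refl | ≡⇒isYes _≟F_ {vertex (e , true)} refl = refl
      ends (inj₂ (refl , refl)) rewrite at≡ (e , false) (vertex (e , false)) | at≡ (e , true) (vertex (e , true))
        | ≡⇒isYes _≟F_ {vertex (e , false)} refl | ≡⇒isYes _≟F_ {vertex (e , true)} refl = ∨-zeroʳ _

    record Adjacent (A : State F) (u w : Fin (nv F)) : Set where
      constructor adjacent
      field adj≡true : adj F A u w ≡ true

    Connected : State F → Fin (nv F) → Fin (nv F) → Set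
    Connected A = Star (Adjacent A)

    edge⇒Connected : ∀ {A e u w} → lookup A e ≡ true → Joins e u w → Connected A u w
    edge⇒Connected {A} {e} {u} {w} Ae joins = adjacent (adj-true⁺ A u w e Ae joins) ◅ ε

    Adjacent-sym : ∀ {A u w} → Adjacent A u w → Adjacent A w u
    Adjacent-sym {A} {u} {w} (adjacent h) with adj-true⁻ A u w h
    ... | e , Ae , joins = adjacent (adj-true⁺ A w u e Ae (Joins-sym joins))

    Connected-sym : ∀ {A v w} → Connected A v w → Connected A w v
    Connected-sym = Star-reverse Adjacent-sym

    Connected-mono : ∀ {A A'} → (∀ e → lookup A e ≡ true → lookup A' e ≡ true) → ∀ {v w} → Connected A v w → Connected A' v w
    Connected-mono sub ε = ε
    Connected-mono {A} {A'} sub {v} (adjacent vu ◅ path) with adj-true⁻ A v _ vu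
    ... | e , Ae , joins = adjacent (adj-true⁺ A' v _ e (sub e Ae) joins) ◅ Connected-mono sub path

    reach⇒Connected : ∀ A v w → reach F A v w ≡ true → Connected A v w
    reach⇒Connected A v w r = Star-map (λ (Closure.edge h) → adjacent h) (Closure.reachIn-sound (nv F) (adj F A) (nv F) v w r)

    Connected⇒reach : ∀ A v w → Connected A v w → reach F A v w ≡ true
    Connected⇒reach A v w c = Closure.reachIn-complete (nv F) (adj F A) v w (Star-map (λ (adjacent h) → Closure.edge h) c)

    IsRoot : State F → Fin (nv F) → Set
    IsRoot A v = ∀ w → Connected A v w → toℕ v ≤ toℕ w

    root? : State F → Fin (nv F) → Bool
    root? A v = all (λ w → not (reach F A v w) ∨ (toℕ v ≤ᵇ toℕ w)) (allFin (nv F))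

    root?-sound : ∀ A v → root? A v ≡ true → IsRoot A v
    root?-sound A v h w vw = ≤ᵇ≡true⁻ _ _ (implied (Connected⇒reach A v w vw) (all⁻ _ (allFin (nv F)) h w (∈-allFin w)))
      where
      implied : ∀ {a b} → a ≡ true → not a ∨ b ≡ true → b ≡ true
      implied refl q = q

    root?-complete : ∀ A v → IsRoot A v → root? A v ≡ true
    root?-complete A v root = all⁺ _ (allFin (nv F)) λ w _ → least w
      where
      least : ∀ w → not (reach F A v w) ∨ (toℕ v ≤ᵇ toℕ w) ≡ true
      least w with reach F A v w in r
      ... | false = refl
      ... | true  = ≤ᵇ≡true⁺ _ _ (root w (reach⇒Connected A v w r))

    root?-false⁻ : ∀ A v → root? A v ≡ false → ∃ λ w → Connected A v w × toℕ w < toℕ v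
    root?-false⁻ A v h with all-false⁻ _ (allFin (nv F)) h
    ... | w , _ , q with reach F A v w in r | toℕ v ≤ᵇ toℕ w in le
    ... | true | false = w , reach⇒Connected A v w r , ≰⇒> (λ v≤w → case trans (sym le) (≤ᵇ≡true⁺ _ _ v≤w) of λ ())

    root-unique : ∀ {A v v'} → IsRoot A v → IsRoot A v' → Connected A v v' → v ≡ v'
    root-unique r r' vv' = toℕ-injective (≤-antisym (r _ vv') (r' _ (Connected-sym vv')))

    k-antitone : ∀ A A' → (∀ e → lookup A e ≡ true → lookup A' e ≡ true) → k F A' ≤ k F A
    k-antitone A A' sub = count-mono (root? A') (root? A) (allFin (nv F)) λ v _ h →
      root?-complete A v (λ w vw → root?-sound A' v h w (Connected-mono sub vw))

    k≤nv : ∀ A → k F A ≤ nv F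
    k≤nv A = subst (k F A ≤_) (length-tabulate (λ i → i)) (count≤length (root? A) (allFin (nv F)))

    k-empty : ∀ A → (∀ e → lookup A e ≡ false) → k F A ≡ nv F
    k-empty A none = trans (count-all (root? A) (allFin (nv F)) λ v _ →
                             root?-complete A v λ w vw → ≤-reflexive (cong toℕ (trivial vw)))
                           (length-tabulate (λ i → i))
      where
      trivial : ∀ {v w} → Connected A v w → v ≡ w
      trivial ε = refl
      trivial {v} (adjacent vu ◅ _) with adj-true⁻ A v _ vu
      ... | e , Ae , _ with () ← trans (sym Ae) (none e)

    -- Adding the edge e to A merges at most the components of its two ends.
    module AddEdge (A : State F) (e : Fin (ne F)) where
      A⁺ : State F
      A⁺ = A Vec.[ e ]≔ true

      x y : Fin (nv F)
      x = vertex (e , false)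
      y = vertex (e , true)

      NearEnd : Fin (nv F) → Set
      NearEnd w = Connected A x w ⊎ Connected A y w

      split : ∀ {v w} → Connected A⁺ v w → Connected A v w ⊎ (NearEnd v × NearEnd w)
      split ε = inj₁ ε
      split {v} (adjacent vu ◅ path) with adj-true⁻ A⁺ v _ vu | split path
      ... | e' , A⁺e' , joins | rest with e' ≟F e
      ... | no e'≢e = prepend rest
        where
        step : Connected A v _
        step = edge⇒Connected (trans (sym (lookup∘updateAt′ e' e e'≢e A)) A⁺e') joins
        prepend : Connected A _ _ ⊎ (NearEnd _ × NearEnd _) → Connected A v _ ⊎ (NearEnd v × NearEnd _)
        prepend (inj₁ c)            = inj₁ (step ◅◅ c)
        prepend (inj₂ (near , far)) = inj₂ (extend near , far)
          where
          extend : NearEnd _ → NearEnd v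
          extend (inj₁ xu) = inj₁ (xu ◅◅ Connected-sym step)
          extend (inj₂ yu) = inj₂ (yu ◅◅ Connected-sym step)
      ... | yes refl = prepend joins rest
        where
        prepend : ∀ {u w} → Joins e v u → Connected A u w ⊎ (NearEnd u × NearEnd w) → Connected A v w ⊎ (NearEnd v × NearEnd w)
        prepend (inj₁ (refl , refl)) (inj₁ c)       = inj₂ (inj₁ ε , inj₂ c)
        prepend (inj₂ (refl , refl)) (inj₁ c)       = inj₂ (inj₂ ε , inj₁ c)
        prepend (inj₁ (refl , refl)) (inj₂ (_ , b)) = inj₂ (inj₁ ε , b)
        prepend (inj₂ (refl , refl)) (inj₂ (_ , b)) = inj₂ (inj₂ ε , b)

      lostRoot : ∀ v → IsRoot A v → root? A⁺ v ≡ false →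
                 ∃ λ w → NearEnd v × NearEnd w × toℕ w < toℕ v × ¬ Connected A v w
      lostRoot v root lost with root?-false⁻ A⁺ v lost
      ... | w , vw , w<v with split vw
      ... | inj₁ c = ⊥-elim (<⇒≱ w<v (root w c))
      ... | inj₂ (nv' , nw) = w , nv' , nw , w<v , (λ c → <⇒≱ w<v (root w c))

      crosses : ∀ {v w} → NearEnd v → NearEnd w → ¬ Connected A v w →
                (Connected A v x × Connected A y w) ⊎ (Connected A v y × Connected A x w)
      crosses (inj₁ xv) (inj₁ xw) nc = ⊥-elim (nc (Connected-sym xv ◅◅ xw))
      crosses (inj₁ xv) (inj₂ yw) nc = inj₁ (Connected-sym xv , yw)
      crosses (inj₂ yv) (inj₁ xw) nc = inj₂ (Connected-sym yv , xw)
      crosses (inj₂ yv) (inj₂ yw) nc = ⊥-elim (nc (Connected-sym yv ◅◅ yw))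

      -- Two lost roots v, v' would have to lie on opposite ends of e, each
      -- connected to a vertex smaller than the other.
      at-most-one-lost : ∀ v v' → root? A v ≡ true → root? A⁺ v ≡ false → root? A v' ≡ true → root? A⁺ v' ≡ false → v ≡ v'
      at-most-one-lost v v' r l r' l' with root?-sound A v r | root?-sound A v' r'
      ... | R | R' with lostRoot v R l | lostRoot v' R' l'
      ... | w , a , b , w<v , nc | w' , a' , b' , w'<v' , nc' with crosses a b nc | crosses a' b' nc'
      ... | inj₁ (vx , _) | inj₁ (v'x , _) = root-unique R R' (vx ◅◅ Connected-sym v'x)
      ... | inj₂ (vy , _) | inj₂ (v'y , _) = root-unique R R' (vy ◅◅ Connected-sym v'y)
      ... | inj₁ (vx , yw) | inj₂ (v'y , xw') =
            ⊥-elim (<-irrefl refl (<-trans (≤-<-trans (R' w (v'y ◅◅ yw)) w<v) (≤-<-trans (R w' (vx ◅◅ xw')) w'<v')))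
      ... | inj₂ (vy , xw) | inj₁ (v'x , yw') =
            ⊥-elim (<-irrefl refl (<-trans (≤-<-trans (R' w (v'x ◅◅ xw)) w<v) (≤-<-trans (R w' (vy ◅◅ yw')) w'<v')))

      k≤1+k⁺ : k F A ≤ suc (k F A⁺)
      k≤1+k⁺ = count≤1+count (root? A) (root? A⁺) (allFin (nv F)) (allFin⁺ (nv F)) at-most-one-lost

    nv≤e+k : ∀ A → nv F ≤ countTrue A + k F A
    nv≤e+k A = go (countTrue A) A refl
      where
      go : ∀ j A → countTrue A ≡ j → nv F ≤ j + k F A
      go zero    A none = ≤-reflexive (sym (k-empty A (countTrue≡0⁻ A none)))
      go (suc j) A ct with countTrue≡suc⁻ A ct
      ... | e , Ae = begin
        nv F                   ≤⟨ go j A⁻ (suc-injective (trans (countTrue-clear A e Ae) ct)) ⟩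
        j + k F A⁻             ≤⟨ +-monoʳ-≤ j (subst (λ B → k F A⁻ ≤ suc (k F B)) restored (AddEdge.k≤1+k⁺ A⁻ e)) ⟩
        j + suc (k F A)        ≡⟨ +-suc j (k F A) ⟩
        suc j + k F A          ∎
        where
        open ≤-Reasoning
        A⁻ = A Vec.[ e ]≔ false
        restored : A⁻ Vec.[ e ]≔ true ≡ A
        restored = trans ([]≔-idempotent A e) (trans (cong (A Vec.[ e ]≔_) (sym Ae)) ([]≔-lookup A e))

  -- The subdivision F ⊗ C₃ and its components

  data SumView (m n : ℕ) : Fin (m + n) → Set where
    left  : (i : Fin m) → SumView m n (i ↑ˡ n)
    right : (j : Fin n) → SumView m n (m ↑ʳ j)

  sumView : ∀ m n (i : Fin (m + n)) → SumView m n i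
  sumView zero    n i           = right i
  sumView (suc m) n Fin.zero    = left Fin.zero
  sumView (suc m) n (Fin.suc i) with sumView m n i
  ... | left j  = left (Fin.suc j)
  ... | right j = right j

  sumView-↑ˡ : ∀ m n (i : Fin m) → sumView m n (i ↑ˡ n) ≡ left i
  sumView-↑ˡ (suc m) n Fin.zero = refl
  sumView-↑ˡ (suc m) n (Fin.suc i) rewrite sumView-↑ˡ m n i = refl

  sumView-↑ʳ : ∀ m n (j : Fin n) → sumView m n (m ↑ʳ j) ≡ right j
  sumView-↑ʳ zero    n j = refl
  sumView-↑ʳ (suc m) n j rewrite sumView-↑ʳ m n j = refl

  ↑ˡ≢↑ʳ : ∀ {m n} (i : Fin m) (j : Fin n) → ¬ i ↑ˡ n ≡ m ↑ʳ j
  ↑ˡ≢↑ʳ {m} {n} i j eq with () ← trans (sym (splitAt-↑ˡ m i n)) (trans (cong (splitAt m) eq) (splitAt-↑ʳ m n j))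

  module Subdivision (F : RibbonGraph) (W : WellFormed F) where
    open WellFormed W

    V E : ℕ
    V = nv F
    E = ne F

    F' : RibbonGraph
    F' = tensorC3 F

    relabel : Dart E → Dart (E + E)
    relabel (e , false) = (e ↑ˡ E , false)
    relabel (e , true)  = (E ↑ʳ e , true)

    inner₁ inner₂ : Fin E → Dart (E + E)
    inner₁ e = (e ↑ˡ E , true)
    inner₂ e = (E ↑ʳ e , false)

    newRot : Fin E → List (Dart (E + E))
    newRot e = inner₁ e ∷ inner₂ e ∷ []

    rot-old : ∀ u → rot F' (u ↑ˡ E) ≡ map relabel (rot F u)
    rot-old u rewrite splitAt-↑ˡ V u E = map-cong (λ { (e , false) → refl ; (e , true) → refl }) (rot F u)

    rot-new : ∀ e → rot F' (V ↑ʳ e) ≡ newRot e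
    rot-new e rewrite splitAt-↑ʳ V E e = refl

    relabel-injective : ∀ {d d'} → relabel d ≡ relabel d' → d ≡ d'
    relabel-injective {e , false} {e' , false} eq = cong (_, false) (↑ˡ-injective E e e' (cong proj₁ eq))
    relabel-injective {e , false} {e' , true}  eq = ⊥-elim (↑ˡ≢↑ʳ e e' (cong proj₁ eq))
    relabel-injective {e , true}  {e' , false} eq = ⊥-elim (↑ˡ≢↑ʳ e' e (sym (cong proj₁ eq)))
    relabel-injective {e , true}  {e' , true}  eq = cong (_, true) (↑ʳ-injective E e e' (cong proj₁ eq))

    inner₁≢relabel : ∀ e d → ¬ inner₁ e ≡ relabel d
    inner₁≢relabel e (e' , false) ()
    inner₁≢relabel e (e' , true)  eq = ↑ˡ≢↑ʳ e e' (cong proj₁ eq)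

    inner₂≢relabel : ∀ e d → ¬ inner₂ e ≡ relabel d
    inner₂≢relabel e (e' , false) eq = ↑ˡ≢↑ʳ e' e (sym (cong proj₁ eq))
    inner₂≢relabel e (e' , true)  ()

    data DartView : Dart (E + E) → Set where
      first  : ∀ e b → DartView (e ↑ˡ E , b)
      second : ∀ e b → DartView (E ↑ʳ e , b)

    dartView : ∀ h → DartView h
    dartView (i , b) with sumView E E i
    ... | left e  = first e b
    ... | right e = second e b

    vertex' : Dart (E + E) → Fin (V + E)
    vertex' h with dartView h
    ... | first e false  = vertex (e , false) ↑ˡ E
    ... | first e true   = V ↑ʳ e
    ... | second e false = V ↑ʳ e
    ... | second e true  = vertex (e , true) ↑ˡ E

    vertex'-first : ∀ e b → vertex' (e ↑ˡ E , b) ≡ (if b then V ↑ʳ e else vertex (e , false) ↑ˡ E)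
    vertex'-first e b rewrite sumView-↑ˡ E E e with b
    ... | false = refl
    ... | true  = refl

    vertex'-second : ∀ e b → vertex' (E ↑ʳ e , b) ≡ (if b then vertex (e , true) ↑ˡ E else V ↑ʳ e)
    vertex'-second e b rewrite sumView-↑ʳ E E e with b
    ... | false = refl
    ... | true  = refl

    vertex'-relabel : ∀ d → vertex' (relabel d) ≡ vertex d ↑ˡ E
    vertex'-relabel (e , false) = vertex'-first e false
    vertex'-relabel (e , true)  = vertex'-second e true

    ∈-rot' : ∀ h → h ∈ rot F' (vertex' h)
    ∈-rot' h = go (dartView h)
      where
      go : ∀ {h} → DartView h → h ∈ rot F' (vertex' h)
      go (first e false)  rewrite vertex'-first e false | rot-old (vertex (e , false)) = ∈-map⁺ relabel (∈-rot (e , false))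
      go (first e true)   rewrite vertex'-first e true | rot-new e = here refl
      go (second e false) rewrite vertex'-second e false | rot-new e = there (here refl)
      go (second e true)  rewrite vertex'-second e true | rot-old (vertex (e , true)) = ∈-map⁺ relabel (∈-rot (e , true))

    ∈-rot'⇒vertex' : ∀ v h → h ∈ rot F' v → vertex' h ≡ v
    ∈-rot'⇒vertex' v h h∈ = go (sumView V E v) h∈
      where
      go : ∀ {v} → SumView V E v → h ∈ rot F' v → vertex' h ≡ v
      go (left u) h∈ rewrite rot-old u with ∈-map⁻ relabel h∈
      ... | d , d∈ , refl = trans (vertex'-relabel d) (cong (_↑ˡ E) (∈-rot⇒vertex u d d∈))
      go (right e) h∈ rewrite rot-new e with h∈
      ... | here refl         = vertex'-first e true
      ... | there (here refl) = vertex'-second e false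

    rot'-unique : ∀ v → Unique (rot F' v)
    rot'-unique v = go (sumView V E v)
      where
      go : ∀ {v} → SumView V E v → Unique (rot F' v)
      go (left u)  rewrite rot-old u = Unique-map⁺ relabel-injective (rot-unique u)
      go (right e) rewrite rot-new e = ((λ eq → ↑ˡ≢↑ʳ e e (cong proj₁ eq)) ∷ []) ∷ [] ∷ []

    W' : WellFormed F'
    W' = record
      { vertex       = vertex'
      ; vertexOf≡    = λ h → firstWith-unique (λ v → memD h (rot F' v)) (∈-allFin _) (memD-true⁺ h (∈-rot' h))
                               (λ v _ h∈ → sym (∈-rot'⇒vertex' v h (memD-true⁻ h _ h∈)))
      ; ∈-rot        = ∈-rot'
      ; rot-unique   = rot'-unique
      ; ∈-rot⇒vertex = ∈-rot'⇒vertex'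
      }

  neither : Bool → Bool → Bool
  neither x y = not x ∧ not y

  module SubdividedState (F : RibbonGraph) (W : WellFormed F) (s₁ s₂ : Vec Bool (ne F)) where
    open WellFormed W
    open Subdivision F W

    A : State F
    A = zipWith _∧_ s₁ s₂

    S' : State F'
    S' = s₁ ++ᵛ s₂

    -- edges of F with neither piece kept; each leaves an isolated new vertex
    nNeither : ℕ
    nNeither = countTrue (zipWith neither s₁ s₂)

    lookup-A : ∀ e → lookup A e ≡ lookup s₁ e ∧ lookup s₂ e
    lookup-A e = lookup-zipWith _∧_ e s₁ s₂

    lookup-S'₁ : ∀ e → lookup S' (e ↑ˡ E) ≡ lookup s₁ e
    lookup-S'₁ e = lookup-++ˡ s₁ s₂ e

    lookup-S'₂ : ∀ e → lookup S' (E ↑ʳ e) ≡ lookup s₂ e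
    lookup-S'₂ e = lookup-++ʳ s₁ s₂ e

    A⇒s₁ : ∀ {e} → lookup A e ≡ true → lookup s₁ e ≡ true
    A⇒s₁ {e} Ae = proj₁ (∧≡true⁻ _ _ (trans (sym (lookup-A e)) Ae))

    A⇒s₂ : ∀ {e} → lookup A e ≡ true → lookup s₂ e ≡ true
    A⇒s₂ {e} Ae = proj₂ (∧≡true⁻ _ _ (trans (sym (lookup-A e)) Ae))

  module SubdivisionComponents (F : RibbonGraph) (W : WellFormed F) (s₁ s₂ : Vec Bool (ne F)) where
    open WellFormed W
    open Subdivision F W
    open SubdividedState F W s₁ s₂
    module C  = Components F W
    module C' = Components F' W'

    new : Fin E → Fin (V + E)
    new e = V ↑ʳ e

    project : Fin (V + E) → Fin V
    project v with sumView V E v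
    ... | left u  = u
    ... | right e = if lookup s₁ e then vertex (e , false) else vertex (e , true)

    project-old : ∀ u → project (u ↑ˡ E) ≡ u
    project-old u rewrite sumView-↑ˡ V E u = refl

    project-new : ∀ e → project (new e) ≡ (if lookup s₁ e then vertex (e , false) else vertex (e , true))
    project-new e rewrite sumView-↑ʳ V E e = refl

    project-edge : ∀ i → lookup S' i ≡ true → C.Connected A (project (vertex' (i , false))) (project (vertex' (i , true)))
    project-edge i S'i = go (sumView E E i) S'i
      where
      go : ∀ {i} → SumView E E i → lookup S' i ≡ true → C.Connected A (project (vertex' (i , false))) (project (vertex' (i , true)))
      go (left e) S'i rewrite vertex'-first e false | vertex'-first e true | project-old (vertex (e , false)) | project-new e
                            | trans (sym (lookup-S'₁ e)) S'i = ε
      go (right e) S'i rewrite vertex'-second e false | vertex'-second e true | project-old (vertex (e , true)) | project-new e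
        with lookup s₁ e in s₁e
      ... | false = ε
      ... | true  = C.edge⇒Connected {A} {e} (trans (lookup-A e) (cong₂ _∧_ s₁e (trans (sym (lookup-S'₂ e)) S'i))) (inj₁ (refl , refl))

    project-Connected : ∀ {x y} → C'.Connected S' x y → C.Connected A (project x) (project y)
    project-Connected ε = ε
    project-Connected {x} (C'.adjacent xu ◅ path) with C'.adj-true⁻ S' x _ xu
    ... | i , S'i , inj₁ (refl , refl) = project-edge i S'i ◅◅ project-Connected path
    ... | i , S'i , inj₂ (refl , refl) = C.Connected-sym (project-edge i S'i) ◅◅ project-Connected path

    embed-edge : ∀ e → lookup A e ≡ true → C'.Connected S' (vertex (e , false) ↑ˡ E) (vertex (e , true) ↑ˡ E)
    embed-edge e Ae =
      C'.edge⇒Connected {S'} {e ↑ˡ E} (trans (lookup-S'₁ e) (A⇒s₁ Ae)) (inj₁ (vertex'-first e false , vertex'-first e true)) ◅◅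
      C'.edge⇒Connected {S'} {E ↑ʳ e} (trans (lookup-S'₂ e) (A⇒s₂ Ae)) (inj₁ (vertex'-second e false , vertex'-second e true))

    embed-Connected : ∀ {u w} → C.Connected A u w → C'.Connected S' (u ↑ˡ E) (w ↑ˡ E)
    embed-Connected ε = ε
    embed-Connected {u} (C.adjacent uv ◅ path) with C.adj-true⁻ A u _ uv
    ... | e , Ae , inj₁ (refl , refl) = embed-edge e Ae ◅◅ embed-Connected path
    ... | e , Ae , inj₂ (refl , refl) = C'.Connected-sym (embed-edge e Ae) ◅◅ embed-Connected path

    new-attached₁ : ∀ e → lookup s₁ e ≡ true → C'.Connected S' (new e) (vertex (e , false) ↑ˡ E)
    new-attached₁ e s₁e = C'.edge⇒Connected {S'} {e ↑ˡ E} (trans (lookup-S'₁ e) s₁e) (inj₂ (vertex'-first e true , vertex'-first e false))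

    new-attached₂ : ∀ e → lookup s₂ e ≡ true → C'.Connected S' (new e) (vertex (e , true) ↑ˡ E)
    new-attached₂ e s₂e = C'.edge⇒Connected {S'} {E ↑ʳ e} (trans (lookup-S'₂ e) s₂e) (inj₁ (vertex'-second e false , vertex'-second e true))

    new-isolated : ∀ e → lookup s₁ e ≡ false → lookup s₂ e ≡ false → ∀ {y} → C'.Connected S' (new e) y → y ≡ new e
    new-isolated e s₁e s₂e ε = refl
    new-isolated e s₁e s₂e (C'.adjacent xu ◅ path) with C'.adj-true⁻ S' (new e) _ xu
    ... | i , S'i , joins = ⊥-elim (go (sumView E E i) S'i joins)
      where
      go : ∀ {i w} → SumView E E i → lookup S' i ≡ true → C'.Joins i (new e) w → ⊥
      go (left e')  _   (inj₁ (q , _)) = ↑ˡ≢↑ʳ _ e (trans (sym (vertex'-first e' false)) q)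
      go (left e')  S'i (inj₂ (q , _)) with ↑ʳ-injective V e' e (trans (sym (vertex'-first e' true)) q)
      ... | refl with () ← trans (sym s₁e) (trans (sym (lookup-S'₁ e)) S'i)
      go (right e') S'i (inj₁ (q , _)) with ↑ʳ-injective V e' e (trans (sym (vertex'-second e' false)) q)
      ... | refl with () ← trans (sym s₂e) (trans (sym (lookup-S'₂ e)) S'i)
      go (right e') _   (inj₂ (q , _)) = ↑ˡ≢↑ʳ _ e (trans (sym (vertex'-second e' true)) q)

    old<new : ∀ (u : Fin V) (e : Fin E) → toℕ (u ↑ˡ E) < toℕ (new e)
    old<new u e = subst₂ _<_ (sym (toℕ-↑ˡ u E)) (sym (toℕ-↑ʳ V e)) (≤-trans (toℕ<n u) (m≤m+n V (toℕ e)))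

    root-old : ∀ u → C'.root? S' (u ↑ˡ E) ≡ C.root? A u
    root-old u with C.root? A u in r | C'.root? S' (u ↑ˡ E) in r'
    ... | true  | true  = refl
    ... | false | false = refl
    ... | true  | false with C'.root?-false⁻ S' (u ↑ˡ E) r'
    ... | y , c , y<u = ⊥-elim (<⇒≱ y<u (go (sumView V E y) c))
      where
      go : ∀ {y} → SumView V E y → C'.Connected S' (u ↑ˡ E) y → toℕ (u ↑ˡ E) ≤ toℕ y
      go (left w)  c = subst₂ _≤_ (sym (toℕ-↑ˡ u E)) (sym (toℕ-↑ˡ w E))
                         (C.root?-sound A u r w (subst₂ (C.Connected A) (project-old u) (project-old w) (project-Connected c)))
      go (right e) c = <⇒≤ (old<new u e)
    root-old u | false | true with C.root?-false⁻ A u r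
    ... | w , c , w<u = ⊥-elim (<⇒≱ (subst₂ _<_ (sym (toℕ-↑ˡ w E)) (sym (toℕ-↑ˡ u E)) w<u)
                                     (C'.root?-sound S' (u ↑ˡ E) r' (w ↑ˡ E) (embed-Connected c)))

    not-root-new : ∀ e u → C'.Connected S' (new e) (u ↑ˡ E) → C'.root? S' (new e) ≡ false
    not-root-new e u c with C'.root? S' (new e) in r
    ... | false = refl
    ... | true  = ⊥-elim (<⇒≱ (old<new u e) (C'.root?-sound S' (new e) r (u ↑ˡ E) c))

    root-new : ∀ e → C'.root? S' (new e) ≡ neither (lookup s₁ e) (lookup s₂ e)
    root-new e with lookup s₁ e in s₁e | lookup s₂ e in s₂e
    ... | true  | _     = not-root-new e (vertex (e , false)) (new-attached₁ e s₁e)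
    ... | false | true  = not-root-new e (vertex (e , true)) (new-attached₂ e s₂e)
    ... | false | false = C'.root?-complete S' (new e) λ y c → ≤-reflexive (cong toℕ (sym (new-isolated e s₁e s₂e c)))

    k-subdivision : k F' S' ≡ k F A + nNeither
    k-subdivision = trans (count-allFin-+ V E (C'.root? S'))
      (cong₂ _+_ (count-cong _ _ (allFin V) (λ u _ → root-old u))
                 (trans (count-cong _ _ (allFin E) (λ e _ → trans (root-new e) (sym (lookup-zipWith neither e s₁ s₂))))
                        (count-lookup (zipWith neither s₁ s₂))))

  -- Successors within a rotation

  module _ {A : Set} (P : A → Bool) where

    None : List A → Set
    None = All (λ x → P x ≡ false)

    firstWith-++-none : ∀ xs {ys} → None xs → firstWith P (xs ++ ys) ≡ firstWith P ys
    firstWith-++-none []       []          = refl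
    firstWith-++-none (x ∷ xs) (px ∷ none) rewrite px = firstWith-++-none xs none

    firstWith-++-∷-true : ∀ xs {y ys} → None xs → P y ≡ true → firstWith P (xs ++ y ∷ ys) ≡ just y
    firstWith-++-∷-true xs {y} {ys} none Py rewrite firstWith-++-none xs {y ∷ ys} none | Py = refl

    firstWith-++-∷-false : ∀ xs {y ys} → None xs → P y ≡ false → firstWith P (xs ++ y ∷ ys) ≡ firstWith P ys
    firstWith-++-∷-false xs {y} {ys} none Py rewrite firstWith-++-none xs {y ∷ ys} none | Py = refl

    firstWith-none : ∀ xs → None xs → firstWith P xs ≡ nothing
    firstWith-none xs none = trans (cong (firstWith P) (sym (++-identityʳ xs))) (firstWith-++-none xs none)

    firstWith-++-nothing : ∀ xs {ys} → firstWith P ys ≡ nothing → firstWith P (xs ++ ys) ≡ firstWith P xs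
    firstWith-++-nothing []       eq = eq
    firstWith-++-nothing (x ∷ xs) eq with P x
    ... | true  = refl
    ... | false = firstWith-++-nothing xs eq

    firstWith-nothing⁻ : ∀ xs → firstWith P xs ≡ nothing → ∀ w → w ∈ xs → P w ≡ false
    firstWith-nothing⁻ (x ∷ xs) eq w w∈ with P x in px
    firstWith-nothing⁻ (x ∷ xs) () w w∈ | true
    firstWith-nothing⁻ (x ∷ xs) eq w (here refl) | false = px
    firstWith-nothing⁻ (x ∷ xs) eq w (there w∈) | false = firstWith-nothing⁻ xs eq w w∈

    firstWith-split : ∀ {xs w} → w ∈ xs → P w ≡ true →
      Σ A λ y → Σ (List A) λ pre → Σ (List A) λ post → xs ≡ pre ++ y ∷ post × None pre × P y ≡ true × firstWith P xs ≡ just y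
    firstWith-split {x ∷ xs} w∈ pw with P x in px
    ... | true = x , [] , xs , refl , [] , px , refl
    firstWith-split {x ∷ xs} (here refl) pw | false with () ← trans (sym pw) px
    firstWith-split {x ∷ xs} (there w∈) pw | false with firstWith-split w∈ pw
    ... | y , pre , post , refl , none , py , eq = y , x ∷ pre , post , refl , px ∷ none , py , eq

  None-mono : {A : Set} (P Q : A → Bool) → (∀ x → P x ≡ true → Q x ≡ true) → ∀ xs → None Q xs → None P xs
  None-mono P Q P⊆Q []       []          = []
  None-mono P Q P⊆Q (x ∷ xs) (qx ∷ none) = px ∷ None-mono P Q P⊆Q xs none
    where
    px : P x ≡ false
    px with P x in eq
    ... | false = refl
    ... | true  with () ← trans (sym (P⊆Q x eq)) qx

  module CyclicOrder {A : Set} (_≟_ : DecidableEquality A) where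

    splitOn : A → List A → List A × List A
    splitOn z []       = [] , []
    splitOn z (y ∷ ys) = if ⌊ y ≟ z ⌋ then ([] , ys) else (y ∷ proj₁ (splitOn z ys) , proj₂ (splitOn z ys))

    cycleAfter : List A → A → List A
    cycleAfter L z = proj₂ (splitOn z L) ++ proj₁ (splitOn z L) ++ [ z ]

    splitOn-++ : ∀ z pre post → z ∉ pre → splitOn z (pre ++ z ∷ post) ≡ (pre , post)
    splitOn-++ z []        post z∉ rewrite ≡⇒isYes _≟_ {z} refl = refl
    splitOn-++ z (x ∷ pre) post z∉ rewrite ≢⇒isNo _≟_ (λ x≡z → z∉ (here (sym x≡z))) | splitOn-++ z pre post (z∉ ∘ there) = refl

    cycleAfter-++ : ∀ z pre post → z ∉ pre → cycleAfter (pre ++ z ∷ post) z ≡ post ++ pre ++ [ z ]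
    cycleAfter-++ z pre post z∉ rewrite splitOn-++ z pre post z∉ = refl

    Unique-∉ : (pre : List A) {z : A} {post : List A} → Unique (pre ++ z ∷ post) → z ∉ pre × z ∉ post
    Unique-∉ []        (z∉ ∷ _) = (λ ()) , All¬⇒¬Any z∉
    Unique-∉ (x ∷ pre) (x∉ ∷ u) with Unique-∉ pre u
    ... | z∉pre , z∉post = (λ { (here refl) → All¬⇒¬Any x∉ (∈-++⁺ʳ pre (here refl)) ; (there z∈) → z∉pre z∈ }) , z∉post

    Unique-split : ∀ {L z} → Unique L → z ∈ L → Σ (List A) λ pre → Σ (List A) λ post → L ≡ pre ++ z ∷ post × z ∉ pre × z ∉ post
    Unique-split u z∈ with ∈-∃++ z∈
    ... | pre , post , refl = pre , post , refl , Unique-∉ pre u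

    ∈-cycleAfter⁺ : ∀ {L z y} → Unique L → z ∈ L → y ∈ L → y ∈ cycleAfter L z
    ∈-cycleAfter⁺ {z = z} {y} u z∈ y∈ with Unique-split u z∈
    ... | pre , post , refl , z∉ , _ rewrite cycleAfter-++ z pre post z∉ with ∈-++⁻ pre y∈
    ... | inj₁ y∈pre         = ∈-++⁺ʳ post (∈-++⁺ˡ y∈pre)
    ... | inj₂ (here refl)   = ∈-++⁺ʳ post (∈-++⁺ʳ pre (here refl))
    ... | inj₂ (there y∈post) = ∈-++⁺ˡ y∈post

    ∈-cycleAfter⁻ : ∀ {L z y} → Unique L → z ∈ L → y ∈ cycleAfter L z → y ∈ L
    ∈-cycleAfter⁻ {z = z} {y} u z∈ y∈ with Unique-split u z∈
    ... | pre , post , refl , z∉ , _ rewrite cycleAfter-++ z pre post z∉ with ∈-++⁻ post y∈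
    ... | inj₁ y∈post = ∈-++⁺ʳ pre (there y∈post)
    ... | inj₂ y∈ with ∈-++⁻ pre y∈
    ... | inj₁ y∈pre       = ∈-++⁺ˡ y∈pre
    ... | inj₂ (here refl) = ∈-++⁺ʳ pre (here refl)

    ++-≡-++-∷ : (xs : List A) {ys : List A} (as : List A) {b : A} {bs : List A} → xs ++ ys ≡ as ++ b ∷ bs →
      (Σ (List A) λ m → xs ≡ as ++ b ∷ m × bs ≡ m ++ ys) ⊎ (Σ (List A) λ m → as ≡ xs ++ m × ys ≡ m ++ b ∷ bs)
    ++-≡-++-∷ []       as       eq = inj₂ (as , refl , eq)
    ++-≡-++-∷ (x ∷ xs) []       refl = inj₁ (xs , refl , refl)
    ++-≡-++-∷ (x ∷ xs) (a ∷ as) eq with refl , eq' ← ∷-injective eq with ++-≡-++-∷ xs as eq'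
    ... | inj₁ (m , p , q) = inj₁ (m , cong (x ∷_) p , q)
    ... | inj₂ (m , p , q) = inj₂ (m , cong (x ∷_) p , q)

    cycleAfter-shift : ∀ {L z y} xs ys → Unique L → z ∈ L → cycleAfter L z ≡ xs ++ y ∷ ys → cycleAfter L y ≡ ys ++ xs ++ [ y ]
    cycleAfter-shift {z = z} {y} xs ys u z∈ eq with Unique-split u z∈
    ... | pre , post , refl , z∉ , _ rewrite cycleAfter-++ z pre post z∉ with ++-≡-++-∷ post xs eq
    ... | inj₁ (m , refl , refl) = begin
        cycleAfter (pre ++ z ∷ xs ++ y ∷ m) y   ≡⟨ cong (λ l → cycleAfter l y) reassoc ⟩
        cycleAfter ((pre ++ z ∷ xs) ++ y ∷ m) y ≡⟨ cycleAfter-++ y (pre ++ z ∷ xs) m (proj₁ (Unique-∉ (pre ++ z ∷ xs) (subst Unique reassoc u))) ⟩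
        m ++ (pre ++ z ∷ xs) ++ [ y ]           ≡⟨ cong (m ++_) (++-assoc pre (z ∷ xs) [ y ]) ⟩
        m ++ pre ++ z ∷ xs ++ [ y ]             ≡⟨ cong (m ++_) (sym (++-assoc pre [ z ] (xs ++ [ y ]))) ⟩
        m ++ (pre ++ [ z ]) ++ xs ++ [ y ]      ≡⟨ sym (++-assoc m (pre ++ [ z ]) (xs ++ [ y ])) ⟩
        (m ++ pre ++ [ z ]) ++ xs ++ [ y ]      ∎
      where
      open ≡-Reasoning
      reassoc : pre ++ z ∷ xs ++ y ∷ m ≡ (pre ++ z ∷ xs) ++ y ∷ m
      reassoc = sym (++-assoc pre (z ∷ xs) (y ∷ m))
    ... | inj₂ (m , refl , eq') with ++-≡-++-∷ pre m eq'
    ... | inj₁ (m' , refl , refl) = begin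
        cycleAfter ((m ++ y ∷ m') ++ z ∷ post) y ≡⟨ cong (λ l → cycleAfter l y) reassoc ⟩
        cycleAfter (m ++ y ∷ m' ++ z ∷ post) y   ≡⟨ cycleAfter-++ y m (m' ++ z ∷ post) (proj₁ (Unique-∉ m (subst Unique reassoc u))) ⟩
        (m' ++ z ∷ post) ++ m ++ [ y ]           ≡⟨ ++-assoc m' (z ∷ post) (m ++ [ y ]) ⟩
        m' ++ z ∷ post ++ m ++ [ y ]             ≡⟨ cong (λ t → m' ++ z ∷ t) (sym (++-assoc post m [ y ])) ⟩
        m' ++ [ z ] ++ (post ++ m) ++ [ y ]      ≡⟨ sym (++-assoc m' [ z ] ((post ++ m) ++ [ y ])) ⟩
        (m' ++ [ z ]) ++ (post ++ m) ++ [ y ]    ∎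
      where
      open ≡-Reasoning
      reassoc : (m ++ y ∷ m') ++ z ∷ post ≡ m ++ y ∷ m' ++ z ∷ post
      reassoc = ++-assoc m (y ∷ m') (z ∷ post)
    ... | inj₂ ([] , refl , refl) = trans (cycleAfter-++ y pre post z∉)
                                          (sym (trans (cong (λ t → (post ++ t) ++ [ y ]) (++-identityʳ pre)) (++-assoc post pre [ y ])))
    ... | inj₂ (_ ∷ [] , refl , ())
    ... | inj₂ (_ ∷ _ ∷ _ , refl , ())

  open module DartOrder {n} = CyclicOrder (_≟D_ {n})

  -- the local function of nextCyc (x ∷ L) h, which cannot be referred to directly
  succWrap : ∀ {n} → Dart n → List (Dart n) → Dart n → Dart n
  succWrap d []           h = d
  succWrap d (y ∷ [])     h = d
  succWrap d (y ∷ z ∷ zs) h = if ⌊ y ≟D h ⌋ then z else succWrap d (z ∷ zs) h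

  nextCyc-∷-≢ : ∀ {n} (x h : Dart n) → ¬ x ≡ h → ∀ L → nextCyc (x ∷ L) h ≡ succWrap x L h
  nextCyc-∷-≢ x h x≢h [] = refl
  nextCyc-∷-≢ x h x≢h (z ∷ []) rewrite ≢⇒isNo _≟D_ x≢h = refl
  nextCyc-∷-≢ x h x≢h (z ∷ w ∷ ws) = trans unfold (cong (if ⌊ z ≟D h ⌋ then w else_) (nextCyc-∷-≢ x h x≢h (w ∷ ws)))
    where
    unfold : nextCyc (x ∷ z ∷ w ∷ ws) h ≡ (if ⌊ z ≟D h ⌋ then w else nextCyc (x ∷ w ∷ ws) h)
    unfold rewrite ≢⇒isNo _≟D_ x≢h with ⌊ z ≟D h ⌋
    ... | true  = refl
    ... | false = refl

  nextCyc-∷ : ∀ {n} (x : Dart n) L h → nextCyc (x ∷ L) h ≡ succWrap x (x ∷ L) h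
  nextCyc-∷ x L h with x ≟D h
  ... | no x≢h = trans (nextCyc-∷-≢ x h x≢h L) (sym (skip L))
    where
    skip : ∀ L → succWrap x (x ∷ L) h ≡ succWrap x L h
    skip []      = refl
    skip (_ ∷ _) rewrite ≢⇒isNo _≟D_ x≢h = refl
  nextCyc-∷ x []      x | yes refl = refl
  nextCyc-∷ x (y ∷ L) x | yes refl rewrite ≡⇒isYes _≟D_ {x} refl = refl

  succWrap-skip : ∀ {n} (d x y z : Dart n) rest → ¬ x ≡ z → succWrap d (x ∷ y ∷ rest) z ≡ succWrap d (y ∷ rest) z
  succWrap-skip d x y z rest x≢z rewrite ≢⇒isNo _≟D_ x≢z = refl

  succWrap-at : ∀ {n} (d z : Dart n) pre post → z ∉ pre → succWrap d (pre ++ z ∷ post) z ≡ fromMaybe d (List.head post)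
  succWrap-at d z []            []      z∉ = refl
  succWrap-at d z []            (y ∷ _) z∉ rewrite ≡⇒isYes _≟D_ {z} refl = refl
  succWrap-at d z (x ∷ [])      post    z∉ =
    trans (succWrap-skip d x z z post (λ x≡z → z∉ (here (sym x≡z)))) (succWrap-at d z [] post (λ ()))
  succWrap-at d z (x ∷ y ∷ pre) post    z∉ =
    trans (succWrap-skip d x y z (pre ++ z ∷ post) (λ x≡z → z∉ (here (sym x≡z)))) (succWrap-at d z (y ∷ pre) post (z∉ ∘ there))

  nextCyc-at : ∀ {n} (z : Dart n) pre post → z ∉ pre → nextCyc (pre ++ z ∷ post) z ≡ fromMaybe z (List.head (post ++ pre ++ [ z ]))
  nextCyc-at z []        post z∉ = trans (nextCyc-∷ z post z) (trans (succWrap-at z z [] post z∉) (headOr post))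
    where
    headOr : ∀ post → fromMaybe z (List.head post) ≡ fromMaybe z (List.head (post ++ [ z ]))
    headOr []      = refl
    headOr (_ ∷ _) = refl
  nextCyc-at z (x ∷ pre) post z∉ = trans (nextCyc-∷ x (pre ++ z ∷ post) z) (trans (succWrap-at x z (x ∷ pre) post z∉) (headOr post))
    where
    headOr : ∀ post → fromMaybe x (List.head post) ≡ fromMaybe z (List.head (post ++ x ∷ pre ++ [ z ]))
    headOr []      = refl
    headOr (_ ∷ _) = refl

  head-filterᵇ : {A : Set} (P : A → Bool) (xs : List A) → List.head (filterᵇ P xs) ≡ firstWith P xs
  head-filterᵇ P []       = refl
  head-filterᵇ P (x ∷ xs) with P x
  ... | true  = refl
  ... | false = head-filterᵇ P xs

  nextCyc-filterᵇ : ∀ {n} (P : Dart n → Bool) {L z} → Unique L → z ∈ L → P z ≡ true →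
                    nextCyc (filterᵇ P L) z ≡ fromMaybe z (firstWith P (cycleAfter L z))
  nextCyc-filterᵇ P {z = z} u z∈ pz with Unique-split u z∈
  ... | pre , post , refl , z∉ , _ = begin
    nextCyc (filterᵇ P (pre ++ z ∷ post)) z                          ≡⟨ cong (λ l → nextCyc l z) (filter-++ (Bool.T? ∘ P) pre (z ∷ post)) ⟩
    nextCyc (filterᵇ P pre ++ filterᵇ P (z ∷ post)) z                ≡⟨ cong (λ l → nextCyc (filterᵇ P pre ++ l) z) (filterᵇ-kept post) ⟩
    nextCyc (filterᵇ P pre ++ z ∷ filterᵇ P post) z                  ≡⟨ nextCyc-at z (filterᵇ P pre) (filterᵇ P post) (z∉ ∘ proj₁ ∘ ∈-filterᵇ⁻ P pre) ⟩
    fromMaybe z (List.head (filterᵇ P post ++ filterᵇ P pre ++ [ z ])) ≡⟨ cong (λ l → fromMaybe z (List.head (filterᵇ P post ++ filterᵇ P pre ++ l))) (sym (filterᵇ-kept [])) ⟩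
    fromMaybe z (List.head (filterᵇ P post ++ filterᵇ P pre ++ filterᵇ P [ z ])) ≡⟨ cong (fromMaybe z ∘ List.head) (sym (filter-++-++ post pre [ z ])) ⟩
    fromMaybe z (List.head (filterᵇ P (post ++ pre ++ [ z ])))        ≡⟨ cong (fromMaybe z) (head-filterᵇ P (post ++ pre ++ [ z ])) ⟩
    fromMaybe z (firstWith P (post ++ pre ++ [ z ]))                  ≡⟨ cong (fromMaybe z ∘ firstWith P) (sym (cycleAfter-++ z pre post z∉)) ⟩
    fromMaybe z (firstWith P (cycleAfter (pre ++ z ∷ post) z))        ∎
    where
    open ≡-Reasoning
    filterᵇ-kept : ∀ l → filterᵇ P (z ∷ l) ≡ z ∷ filterᵇ P l
    filterᵇ-kept l rewrite pz = refl
    filter-++-++ : ∀ a b c → filterᵇ P (a ++ b ++ c) ≡ filterᵇ P a ++ filterᵇ P b ++ filterᵇ P c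
    filter-++-++ a b c = trans (filter-++ (Bool.T? ∘ P) a (b ++ c)) (cong (filterᵇ P a ++_) (filter-++ (Bool.T? ∘ P) b c))

  module _ {n m : ℕ} (g : Dart n → Dart m) (g-injective : ∀ {a b} → g a ≡ g b → a ≡ b) where

    succWrap-map : ∀ d L h → succWrap (g d) (map g L) (g h) ≡ g (succWrap d L h)
    succWrap-map d []           h = refl
    succWrap-map d (y ∷ [])     h = refl
    succWrap-map d (y ∷ z ∷ zs) h = begin
      (if ⌊ g y ≟D g h ⌋ then g z else succWrap (g d) (map g (z ∷ zs)) (g h)) ≡⟨ cong (if_then g z else _) same-test ⟩
      (if ⌊ y ≟D h ⌋ then g z else succWrap (g d) (map g (z ∷ zs)) (g h))     ≡⟨ cong (if ⌊ y ≟D h ⌋ then g z else_) (succWrap-map d (z ∷ zs) h) ⟩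
      (if ⌊ y ≟D h ⌋ then g z else g (succWrap d (z ∷ zs) h))                 ≡⟨ if-float g ⌊ y ≟D h ⌋ ⟨
      g (if ⌊ y ≟D h ⌋ then z else succWrap d (z ∷ zs) h)                     ∎
      where
      open ≡-Reasoning
      same-test : ⌊ g y ≟D g h ⌋ ≡ ⌊ y ≟D h ⌋
      same-test with y ≟D h
      ... | yes y≡h = ≡⇒isYes _≟D_ (cong g y≡h)
      ... | no y≢h  = ≢⇒isNo _≟D_ (y≢h ∘ g-injective)

    nextCyc-map : ∀ L d → nextCyc (map g L) (g d) ≡ g (nextCyc L d)
    nextCyc-map []      d = refl
    nextCyc-map (x ∷ L) d = trans (nextCyc-∷ (g x) (map g L) (g d)) (trans (succWrap-map x (x ∷ L) d) (cong g (sym (nextCyc-∷ x L d))))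

  iter-suc : {X : Set} (g : X → X) → ∀ j z → iter g j (g z) ≡ iter g (suc j) z
  iter-suc g zero    z = refl
  iter-suc g (suc j) z = cong g (iter-suc g j z)

  iter-+ : {X : Set} (g : X → X) → ∀ a b x → iter g (a + b) x ≡ iter g a (iter g b x)
  iter-+ g zero    b x = refl
  iter-+ g (suc a) b x = cong g (iter-+ g a b x)

  module RotationSuccessor {n : ℕ} {L : List (Dart n)} (unique : Unique L) where

    nextIn : (Dart n → Bool) → Dart n → Dart n
    nextIn B z = fromMaybe z (firstWith B (cycleAfter L z))

    module _ (B : Dart n → Bool) {z : Dart n} (z∈ : z ∈ L) (Bz : B z ≡ true) where

      nextIn-split : Σ (List (Dart n)) λ xs → Σ (List (Dart n)) λ ys →
                     cycleAfter L z ≡ xs ++ nextIn B z ∷ ys × None B xs × B (nextIn B z) ≡ true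
      nextIn-split with firstWith-split B (∈-cycleAfter⁺ unique z∈ z∈) Bz
      ... | y , xs , ys , eq , none , By , first rewrite first = xs , ys , eq , none , By

      nextIn-∈ : nextIn B z ∈ L
      nextIn-∈ with nextIn-split
      ... | xs , ys , eq , _ , _ = ∈-cycleAfter⁻ unique z∈ (subst (nextIn B z ∈_) (sym eq) (∈-++⁺ʳ xs (here refl)))

      nextIn-B : B (nextIn B z) ≡ true
      nextIn-B = proj₂ (proj₂ (proj₂ (proj₂ nextIn-split)))

    module _ (A B : Dart n → Bool) (A⊆B : ∀ d → A d ≡ true → B d ≡ true) {z : Dart n} (z∈ : z ∈ L) (Bz : B z ≡ true) where

      firstWith-nextIn-A : A (nextIn B z) ≡ true → firstWith A (cycleAfter L z) ≡ just (nextIn B z)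
      firstWith-nextIn-A Ay with nextIn-split B z∈ Bz
      ... | xs , ys , eq , none , _ = trans (cong (firstWith A) eq) (firstWith-++-∷-true A xs (None-mono A B A⊆B xs none) Ay)

      firstWith-nextIn-¬A : A (nextIn B z) ≡ false → firstWith A (cycleAfter L (nextIn B z)) ≡ firstWith A (cycleAfter L z)
      firstWith-nextIn-¬A Ay with nextIn-split B z∈ Bz
      ... | xs , ys , eq , none , _ = begin
        firstWith A (cycleAfter L y)          ≡⟨ cong (firstWith A) (cycleAfter-shift xs ys unique z∈ eq) ⟩
        firstWith A (ys ++ xs ++ [ y ])       ≡⟨ firstWith-++-nothing A ys (firstWith-none A (xs ++ [ y ]) (All-++⁺ noneA (Ay ∷ []))) ⟩
        firstWith A ys                        ≡⟨ firstWith-++-∷-false A xs noneA Ay ⟨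
        firstWith A (xs ++ y ∷ ys)            ≡⟨ cong (firstWith A) eq ⟨
        firstWith A (cycleAfter L z)          ∎
        where
        open ≡-Reasoning
        y = nextIn B z
        noneA = None-mono A B A⊆B xs none

    firstIndex : (Dart n → Bool) → List (Dart n) → ℕ
    firstIndex A []       = 0
    firstIndex A (x ∷ xs) = if A x then 0 else suc (firstIndex A xs)

    firstIndex-++-just : ∀ A ys r {t} → firstWith A ys ≡ just t → firstIndex A (ys ++ r) ≡ firstIndex A ys
    firstIndex-++-just A (y ∷ ys) r eq with A y
    ... | true  = refl
    ... | false = cong suc (firstIndex-++-just A ys r eq)

    firstIndex-++-none : ∀ A xs ys → None A xs → firstIndex A (xs ++ ys) ≡ length xs + firstIndex A ys
    firstIndex-++-none A []       ys []          = refl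
    firstIndex-++-none A (x ∷ xs) ys (Ax ∷ none) rewrite Ax = cong suc (firstIndex-++-none A xs ys none)

    -- Each B-step strictly shortens the distance to the first A-dart, which is therefore reached.
    walk : (A B : Dart n → Bool) (A⊆B : ∀ d → A d ≡ true → B d ≡ true) (g : Dart n → Dart n) →
           (∀ z → z ∈ L → B z ≡ true → A z ≡ false → g z ≡ nextIn B z) →
           ∀ {z t} → z ∈ L → B z ≡ true → A z ≡ false → firstWith A (cycleAfter L z) ≡ just t → ∃ λ j → iter g j z ≡ t
    walk A B A⊆B g g≡ z∈ Bz Az first = go _ ≤-refl z∈ Bz Az first
      where
      go : ∀ k {z t} → firstIndex A (cycleAfter L z) ≤ k → z ∈ L → B z ≡ true → A z ≡ false →
           firstWith A (cycleAfter L z) ≡ just t → ∃ λ j → iter g j z ≡ t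
      go k {z} {t} bound z∈ Bz Az first with A (nextIn B z) in Ay
      ... | true = 1 , trans (g≡ z z∈ Bz Az) (just-injective (trans (sym (firstWith-nextIn-A A B A⊆B z∈ Bz Ay)) first))
      ... | false with nextIn-split B z∈ Bz
      ... | xs , ys , eq , none , _ = step k bound
        where
        y = nextIn B z
        noneA = None-mono A B A⊆B xs none
        index≡ : firstIndex A (cycleAfter L z) ≡ length xs + suc (firstIndex A ys)
        index≡ = trans (cong (firstIndex A) eq) (trans (firstIndex-++-none A xs (y ∷ ys) noneA) (cong (λ b → length xs + (if b then 0 else suc (firstIndex A ys))) Ay))
        first-ys : firstWith A ys ≡ just t
        first-ys = trans (sym (firstWith-++-∷-false A xs noneA Ay)) (trans (cong (firstWith A) (sym eq)) first)
        index-y : firstIndex A (cycleAfter L y) ≡ firstIndex A ys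
        index-y = trans (cong (firstIndex A) (cycleAfter-shift xs ys unique z∈ eq)) (firstIndex-++-just A ys (xs ++ [ y ]) first-ys)
        step : ∀ k → firstIndex A (cycleAfter L z) ≤ k → ∃ λ j → iter g j z ≡ t
        step zero    bound with () ← subst (_≤ 0) (trans index≡ (+-suc (length xs) _)) bound
        step (suc k) bound =
          let bound' = ≤-pred (≤-trans (s≤s (≤-trans (≤-reflexive index-y) (m≤n+m _ (length xs))))
                                       (≤-trans (≤-reflexive (trans (sym (+-suc (length xs) _)) (sym index≡))) bound))
              (j , reached) = go k bound' (nextIn-∈ B z∈ Bz) (nextIn-B B z∈ Bz) Ay
                                 (trans (firstWith-nextIn-¬A A B A⊆B z∈ Bz Ay) first)
          in suc j , trans (sym (iter-suc g j z)) (trans (cong (iter g j) (g≡ z z∈ Bz Az)) reached)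

    firstWith-∈-prefix : ∀ (B : Dart n → Bool) xs {w ys} d → B w ≡ true → fromMaybe d (firstWith B (xs ++ w ∷ ys)) ∈ xs ++ [ w ]
    firstWith-∈-prefix B []       d Bw rewrite Bw = here refl
    firstWith-∈-prefix B (x ∷ xs) d Bw with B x
    ... | true  = here refl
    ... | false = there (firstWith-∈-prefix B xs d Bw)

    -- If L = a ++ z ∷ b ++ z' ∷ c then the successor of z lies in b ++ [ z' ] and
    -- that of z' in c ++ a ++ [ z ]; these are disjoint parts of L.
    nextIn-separated : ∀ B a z b z' c → L ≡ a ++ z ∷ b ++ z' ∷ c → B z ≡ true → B z' ≡ true → ¬ nextIn B z ≡ nextIn B z'
    nextIn-separated B a z b z' c refl Bz Bz' eq = disjoint (∈-++⁻ (c ++ a) in-cza)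
      where
      z∉ = Unique-∉ a {z} {b ++ z' ∷ c} unique
      L≡ : L ≡ (a ++ z ∷ b) ++ z' ∷ c
      L≡ = sym (++-assoc a (z ∷ b) (z' ∷ c))
      z'∉ = Unique-∉ (a ++ z ∷ b) (subst Unique L≡ unique)
      cyc-z : cycleAfter L z ≡ b ++ z' ∷ (c ++ a ++ [ z ])
      cyc-z = trans (cycleAfter-++ z a (b ++ z' ∷ c) (proj₁ z∉)) (++-assoc b (z' ∷ c) (a ++ [ z ]))
      cyc-z' : cycleAfter L z' ≡ (c ++ a) ++ z ∷ (b ++ [ z' ])
      cyc-z' = trans (cong (λ l → cycleAfter l z') L≡) (trans (cycleAfter-++ z' (a ++ z ∷ b) c (proj₁ z'∉))
                 (trans (cong (c ++_) (++-assoc a (z ∷ b) [ z' ])) (sym (++-assoc c a (z ∷ b ++ [ z' ])))))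
      in-bz' : nextIn B z ∈ b ++ [ z' ]
      in-bz' = subst (λ l → fromMaybe z (firstWith B l) ∈ b ++ [ z' ]) (sym cyc-z) (firstWith-∈-prefix B b z Bz')
      in-cza : nextIn B z ∈ (c ++ a) ++ [ z ]
      in-cza = subst (_∈ (c ++ a) ++ [ z ]) (sym eq)
                 (subst (λ l → fromMaybe z' (firstWith B l) ∈ (c ++ a) ++ [ z ]) (sym cyc-z') (firstWith-∈-prefix B (c ++ a) z' Bz))
      widen : ∀ {y} → y ∈ b ++ [ z' ] → y ∈ b ++ z' ∷ c
      widen y∈ with ∈-++⁻ b y∈
      ... | inj₁ y∈b       = ∈-++⁺ˡ y∈b
      ... | inj₂ (here refl) = ∈-++⁺ʳ b (here refl)
      disjoint : nextIn B z ∈ c ++ a ⊎ nextIn B z ∈ [ z ] → ⊥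
      disjoint (inj₂ (here y≡z)) = proj₂ z∉ (widen (subst (_∈ b ++ [ z' ]) y≡z in-bz'))
      disjoint (inj₁ y∈) with ∈-++⁻ c y∈
      ... | inj₂ y∈a = Unique-++-disjoint a unique y∈a (there (widen in-bz'))
      ... | inj₁ y∈c = Unique-++-disjoint (a ++ z ∷ b ++ [ z' ]) (subst Unique L≡' unique) (∈-++⁺ʳ a (there in-bz')) y∈c
        where
        L≡' : L ≡ (a ++ z ∷ b ++ [ z' ]) ++ c
        L≡' = sym (trans (++-assoc a (z ∷ b ++ [ z' ]) c) (cong (λ t → a ++ z ∷ t) (++-assoc b [ z' ] c)))

    nextIn-injective : ∀ B {z z'} → z ∈ L → z' ∈ L → B z ≡ true → B z' ≡ true → nextIn B z ≡ nextIn B z' → z ≡ z'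
    nextIn-injective B {z} {z'} z∈ z'∈ Bz Bz' eq with z ≟D z'
    ... | yes z≡z' = z≡z'
    ... | no z≢z' with Unique-split unique z∈
    ... | pre , post , L≡ , _ with ∈-++⁻ pre (subst (z' ∈_) L≡ z'∈)
    ... | inj₂ (here z'≡z) = ⊥-elim (z≢z' (sym z'≡z))
    ... | inj₂ (there z'∈post) with ∈-∃++ z'∈post
    ... | b , c , refl = ⊥-elim (nextIn-separated B pre z b z' c L≡ Bz Bz' eq)
    nextIn-injective B {z} {z'} z∈ z'∈ Bz Bz' eq | no z≢z' | pre , post , L≡ , _ | inj₁ z'∈pre with ∈-∃++ z'∈pre
    ... | a , b , refl = ⊥-elim (nextIn-separated B a z' b z post (trans L≡ (++-assoc a (z' ∷ b) (z ∷ post))) Bz' Bz (sym eq))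

  -- Orbits and boundary components

  bitFin : Bool → Fin 2
  bitFin false = Fin.zero
  bitFin true  = Fin.suc Fin.zero

  dartIndex : ∀ {n} → Dart n → Fin (n * 2)
  dartIndex (e , b) = Fin.combine e (bitFin b)

  toℕ-dartIndex : ∀ {n} (h : Dart n) → toℕ (dartIndex h) ≡ code h
  toℕ-dartIndex (e , b) = trans (toℕ-combine e (bitFin b)) (cong (2 * toℕ e +_) (bit b))
    where
    bit : ∀ b → toℕ (bitFin b) ≡ (if b then 1 else 0)
    bit false = refl
    bit true  = refl

  dartIndex-injective : ∀ {n} {h h' : Dart n} → dartIndex h ≡ dartIndex h' → h ≡ h'
  dartIndex-injective {h = e , b} {e' , b'} eq with combine-injective e (bitFin b) e' (bitFin b') eq
  dartIndex-injective {h = e , false} {e , false} eq | refl , _ = refl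
  dartIndex-injective {h = e , true}  {e , true}  eq | refl , _ = refl

  code-injective : ∀ {n} {h h' : Dart n} → code h ≡ code h' → h ≡ h'
  code-injective {h = h} {h'} eq = dartIndex-injective (toℕ-injective (trans (toℕ-dartIndex h) (trans eq (sym (toℕ-dartIndex h')))))

  module Orbits {n : ℕ} (f : Dart n → Dart n) (P : Dart n → Bool)
                (f-closed : ∀ x → P x ≡ true → P (f x) ≡ true)
                (f-injective : ∀ x y → P x ≡ true → P y ≡ true → f x ≡ f y → x ≡ y) where

    Orbit : Dart n → Dart n → Set
    Orbit x y = ∃ λ i → iter f i x ≡ y

    Orbit-refl : ∀ x → Orbit x x
    Orbit-refl x = 0 , refl

    Orbit-step : ∀ x → Orbit x (f x)
    Orbit-step x = 1 , refl

    Orbit-trans : ∀ {x y z} → Orbit x y → Orbit y z → Orbit x z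
    Orbit-trans {x} (i , refl) (j , refl) = j + i , iter-+ f j i x

    iter-closed : ∀ i x → P x ≡ true → P (iter f i x) ≡ true
    iter-closed zero    x Px = Px
    iter-closed (suc i) x Px = f-closed _ (iter-closed i x Px)

    Orbit-closed : ∀ {x y} → P x ≡ true → Orbit x y → P y ≡ true
    Orbit-closed Px (i , refl) = iter-closed i _ Px

    iter-cancel : ∀ i x y → P x ≡ true → P y ≡ true → iter f i x ≡ iter f i y → x ≡ y
    iter-cancel zero    x y Px Py eq = eq
    iter-cancel (suc i) x y Px Py eq = iter-cancel i x y Px Py (f-injective _ _ (iter-closed i x Px) (iter-closed i y Py) eq)

    -- By pigeonhole two of the first 2n + 1 iterates coincide; injectivity makes x itself recur.
    period : ∀ x → P x ≡ true → ∃ λ j → 0 < j × j ≤ n * 2 × iter f j x ≡ x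
    period x Px with pigeonhole (n<1+n (n * 2)) (λ (i : Fin (suc (n * 2))) → dartIndex (iter f (toℕ i) x))
    ... | i , j , i<j , same = d , m<n⇒0<n∸m i<j , ≤-trans (m∸n≤m (toℕ j) (toℕ i)) (≤-pred (toℕ<n j)) ,
                               iter-cancel (toℕ i) _ _ (iter-closed d x Px) Px shifted
      where
      d = toℕ j ∸ toℕ i
      shifted : iter f (toℕ i) (iter f d x) ≡ iter f (toℕ i) x
      shifted = trans (sym (iter-+ f (toℕ i) d x))
                      (trans (cong (λ t → iter f t x) (m+[n∸m]≡n (<⇒≤ i<j))) (sym (dartIndex-injective same)))

    iter-period : ∀ j x → iter f j x ≡ x → ∀ m → iter f (m * j) x ≡ x
    iter-period j x fix zero    = refl
    iter-period j x fix (suc m) = trans (iter-+ f j (m * j) x) (trans (cong (iter f j) (iter-period j x fix m)) fix)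

    Orbit-sym : ∀ {x y} → P x ≡ true → Orbit x y → Orbit y x
    Orbit-sym {x} Px (i , refl) with period x Px
    ... | suc j , _ , _ , fix = j * i , trans (sym (iter-+ f (j * i) i x))
            (trans (cong (λ t → iter f t x) (trans (+-comm (j * i) i) (*-comm (suc j) i))) (iter-period (suc j) x fix i))

    iter-reduce : ∀ x → P x ≡ true → ∀ i → ∃ λ r → r ≤ n * 2 × iter f i x ≡ iter f r x
    iter-reduce x Px i with period x Px
    ... | suc j , _ , j<2n , fix = i % suc j , ≤-trans (<⇒≤ (m%n<n i (suc j))) j<2n ,
            trans (cong (λ t → iter f t x) (m≡m%n+[m/n]*n i (suc j)))
                  (trans (iter-+ f (i % suc j) (i / suc j * suc j) x) (cong (iter f (i % suc j)) (iter-period (suc j) x fix (i / suc j))))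

    orbitMin-sound : ∀ x → P x ≡ true → orbitMin f x ≡ true → ∀ y → Orbit x y → code x ≤ code y
    orbitMin-sound x Px least y (i , refl) with iter-reduce x Px i
    ... | r , r≤ , eq = subst (λ t → code x ≤ code t) (sym eq)
                          (≤ᵇ≡true⁻ _ _ (all⁻ _ (upTo (suc (2 * n))) least r (∈-upTo⁺ (s≤s (subst (r ≤_) (*-comm n 2) r≤)))))

    orbitMin-complete : ∀ x → (∀ y → Orbit x y → code x ≤ code y) → orbitMin f x ≡ true
    orbitMin-complete x least = all⁺ _ (upTo (suc (2 * n))) (λ i _ → ≤ᵇ≡true⁺ _ _ (least _ (i , refl)))

    orbitMin-unique : ∀ r r' → P r ≡ true → orbitMin f r ≡ true → orbitMin f r' ≡ true → Orbit r r' → r ≡ r'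
    orbitMin-unique r r' Pr min min' rr' =
      code-injective (≤-antisym (orbitMin-sound r Pr min r' rr') (orbitMin-sound r' (Orbit-closed Pr rr') min' r (Orbit-sym Pr rr')))

    minByCode : Dart n → List (Dart n) → Dart n
    minByCode d []       = d
    minByCode d (y ∷ ys) = if code y ≤ᵇ code (minByCode d ys) then y else minByCode d ys

    minByCode-∈ : ∀ d ys → minByCode d ys ≡ d ⊎ minByCode d ys ∈ ys
    minByCode-∈ d []       = inj₁ refl
    minByCode-∈ d (y ∷ ys) with code y ≤ᵇ code (minByCode d ys)
    ... | true  = inj₂ (here refl)
    ... | false with minByCode-∈ d ys
    ... | inj₁ eq = inj₁ eq
    ... | inj₂ m∈ = inj₂ (there m∈)

    minByCode-≤ : ∀ d ys y → y ∈ ys → code (minByCode d ys) ≤ code y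
    minByCode-≤ d (y ∷ ys) z z∈ with code y ≤ᵇ code (minByCode d ys) in le
    minByCode-≤ d (y ∷ ys) z (here refl) | true  = ≤-refl
    minByCode-≤ d (y ∷ ys) z (there z∈)  | true  = ≤-trans (≤ᵇ≡true⁻ _ _ le) (minByCode-≤ d ys z z∈)
    minByCode-≤ d (y ∷ ys) z (here refl) | false = <⇒≤ (≰⇒> λ y≤ → case trans (sym le) (≤ᵇ≡true⁺ _ _ y≤) of λ ())
    minByCode-≤ d (y ∷ ys) z (there z∈)  | false = minByCode-≤ d ys z z∈

    leastInOrbit : Dart n → Dart n
    leastInOrbit x = minByCode x (map (λ i → iter f i x) (upTo (suc (n * 2))))

    leastInOrbit-Orbit : ∀ x → Orbit x (leastInOrbit x)
    leastInOrbit-Orbit x with minByCode-∈ x (map (λ i → iter f i x) (upTo (suc (n * 2))))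
    ... | inj₁ eq = 0 , sym eq
    ... | inj₂ m∈ with ∈-map⁻ (λ i → iter f i x) {xs = upTo (suc (n * 2))} m∈
    ... | i , _ , eq = i , sym eq

    leastInOrbit-min : ∀ x → P x ≡ true → orbitMin f (leastInOrbit x) ≡ true
    leastInOrbit-min x Px = orbitMin-complete (leastInOrbit x) λ y lx→y →
      let (i , eq) = Orbit-trans (leastInOrbit-Orbit x) lx→y
          (r , r≤ , eq') = iter-reduce x Px i
      in subst (λ t → code (leastInOrbit x) ≤ code t) (trans (sym eq') eq)
               (minByCode-≤ x _ _ (∈-map⁺ (λ i → iter f i x) (∈-upTo⁺ (s≤s r≤))))

  module _ {A : Set} where

    Unique-drop : ∀ (xs : List A) {y ys} → Unique (xs ++ y ∷ ys) → Unique (xs ++ ys)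
    Unique-drop []       (_ ∷ u)  = u
    Unique-drop (x ∷ xs) (x∉ ∷ u) = All-++⁺ (++⁻ˡ xs x∉) (All.tail (++⁻ʳ xs x∉)) ∷ Unique-drop xs u

    Unique-dropped : ∀ (xs : List A) {y ys} → Unique (xs ++ y ∷ ys) → ∀ {x} → x ∈ xs ++ ys → ¬ x ≡ y
    Unique-dropped []       (y∉ ∷ u) x∈ refl = All¬⇒¬Any y∉ x∈
    Unique-dropped (z ∷ xs) (z∉ ∷ u) (here refl) refl = All¬⇒¬Any z∉ (∈-++⁺ʳ xs (here refl))
    Unique-dropped (z ∷ xs) (z∉ ∷ u) (there x∈) eq = Unique-dropped xs u x∈ eq

    Unique-⊆⇒length≤ : DecidableEquality A → ∀ xs ys → Unique xs → (∀ x → x ∈ xs → x ∈ ys) → length xs ≤ length ys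
    Unique-⊆⇒length≤ _≟_ []       ys       u sub = z≤n
    Unique-⊆⇒length≤ _≟_ (x ∷ xs) []       u sub with () ← sub x (here refl)
    Unique-⊆⇒length≤ _≟_ xs       (y ∷ ys) u sub with DecMembership._∈?_ _≟_ y xs
    ... | no y∉xs = m≤n⇒m≤1+n (Unique-⊆⇒length≤ _≟_ xs ys u λ x x∈ → elsewhere x∈ (sub x x∈))
      where
      elsewhere : ∀ {x} → x ∈ xs → x ∈ y ∷ ys → x ∈ ys
      elsewhere x∈ (here refl) = ⊥-elim (y∉xs x∈)
      elsewhere x∈ (there x∈ys) = x∈ys
    ... | yes y∈xs with ∈-∃++ y∈xs
    ... | pre , post , refl = begin
      length (pre ++ y ∷ post)  ≡⟨ length-++ pre ⟩
      length pre + suc (length post) ≡⟨ +-suc (length pre) (length post) ⟩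
      suc (length pre + length post) ≡⟨ cong suc (length-++ pre) ⟨
      suc (length (pre ++ post)) ≤⟨ s≤s (Unique-⊆⇒length≤ _≟_ (pre ++ post) ys (Unique-drop pre u) λ x x∈ → elsewhere x∈ (sub x (widen x∈))) ⟩
      suc (length ys)           ∎
      where
      open ≤-Reasoning
      widen : ∀ {x} → x ∈ pre ++ post → x ∈ pre ++ y ∷ post
      widen x∈ with ∈-++⁻ pre x∈
      ... | inj₁ x∈pre  = ∈-++⁺ˡ x∈pre
      ... | inj₂ x∈post = ∈-++⁺ʳ pre (there x∈post)
      elsewhere : ∀ {x} → x ∈ pre ++ post → x ∈ y ∷ ys → x ∈ ys
      elsewhere x∈ (here x≡y)  = ⊥-elim (Unique-dropped pre u x∈ x≡y)
      elsewhere x∈ (there x∈ys) = x∈ys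

  Unique-map-injectiveOn : {A B : Set} (h : A → B) (xs : List A) → Unique xs →
    (∀ {x x'} → x ∈ xs → x' ∈ xs → h x ≡ h x' → x ≡ x') → Unique (map h xs)
  Unique-map-injectiveOn h []       []       inj = []
  Unique-map-injectiveOn h (x ∷ xs) (x∉ ∷ u) inj =
    All.tabulate fresh ∷ Unique-map-injectiveOn h xs u (λ a b → inj (there a) (there b))
    where
    fresh : ∀ {y} → y ∈ map h xs → ¬ h x ≡ y
    fresh y∈ refl with ∈-map⁻ h y∈
    ... | x' , x'∈ , eq = All¬⇒¬Any x∉ (subst (_∈ xs) (sym (inj (here refl) (there x'∈) eq)) x'∈)

  injectiveOn⇒length≤ : {A B : Set} → DecidableEquality B → (h : A → B) (xs : List A) (ys : List B) → Unique xs →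
    (∀ x → x ∈ xs → h x ∈ ys) → (∀ {x x'} → x ∈ xs → x' ∈ xs → h x ≡ h x' → x ≡ x') → length xs ≤ length ys
  injectiveOn⇒length≤ _≟_ h xs ys u into inj = begin
    length xs         ≡⟨ length-map h xs ⟨
    length (map h xs) ≤⟨ Unique-⊆⇒length≤ _≟_ (map h xs) ys (Unique-map-injectiveOn h xs u inj) into′ ⟩
    length ys         ∎
    where
    open ≤-Reasoning
    into′ : ∀ y → y ∈ map h xs → y ∈ ys
    into′ y y∈ with ∈-map⁻ h y∈
    ... | x , x∈ , refl = into x x∈

  record Classes : Set₁ where
    field
      Carrier        : Set
      decEq          : DecidableEquality Carrier
      elements       : List Carrier
      unique         : Unique elements
      inDomain       : Carrier → Bool
      _∼_            : Carrier → Carrier → Set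
      ∼-sym          : ∀ {x y} → inDomain x ≡ true → x ∼ y → y ∼ x
      ∼-trans        : ∀ {x y z} → x ∼ y → y ∼ z → x ∼ z
      isRep          : Carrier → Bool
      isRep⇒inDomain : ∀ x → isRep x ≡ true → inDomain x ≡ true
      isRep-unique   : ∀ x y → isRep x ≡ true → isRep y ≡ true → x ∼ y → x ≡ y
      rep            : Carrier → Carrier
      rep-isRep      : ∀ x → inDomain x ≡ true → isRep (rep x) ≡ true × x ∼ rep x
      ∈-elements     : ∀ x → inDomain x ≡ true → x ∈ elements

    nClasses : ℕ
    nClasses = count isRep elements

  module _ (S T : Classes) (g : Classes.Carrier S → Classes.Carrier T) where
    private
      module S = Classes S
      module T = Classes T

    nClasses-≡ : (∀ x → S.inDomain x ≡ true → T.inDomain (g x) ≡ true) →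
                 (∀ x x' → S.inDomain x ≡ true → S.inDomain x' ≡ true → g x T.∼ g x' → x S.∼ x') →
                 (∀ x x' → S.inDomain x ≡ true → S.inDomain x' ≡ true → x S.∼ x' → g x T.∼ g x') →
                 (∀ y → T.inDomain y ≡ true → ∃ λ x → S.inDomain x ≡ true × g x T.∼ y) →
                 S.nClasses ≡ T.nClasses
    nClasses-≡ g-dom g-reflects g-preserves g-onto = ≤-antisym S≤T T≤S
      where
      repsS = filterᵇ S.isRep S.elements
      repsT = filterᵇ T.isRep T.elements

      φ : S.Carrier → T.Carrier
      φ x = T.rep (g x)

      φ-isRep : ∀ x → S.isRep x ≡ true → T.isRep (φ x) ≡ true × g x T.∼ φ x
      φ-isRep x r = T.rep-isRep (g x) (g-dom x (S.isRep⇒inDomain x r))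

      S≤T : S.nClasses ≤ T.nClasses
      S≤T = injectiveOn⇒length≤ T.decEq φ repsS repsT (filter⁺ _ S.unique) into inj
        where
        into : ∀ x → x ∈ repsS → φ x ∈ repsT
        into x x∈ = let r = proj₂ (∈-filterᵇ⁻ S.isRep S.elements x∈); r' = proj₁ (φ-isRep x r)
                    in ∈-filterᵇ⁺ T.isRep (T.∈-elements _ (T.isRep⇒inDomain _ r')) r'
        inj : ∀ {x x'} → x ∈ repsS → x' ∈ repsS → φ x ≡ φ x' → x ≡ x'
        inj {x} {x'} x∈ x'∈ eq =
          let r = proj₂ (∈-filterᵇ⁻ S.isRep S.elements x∈); r' = proj₂ (∈-filterᵇ⁻ S.isRep S.elements x'∈)
              d = S.isRep⇒inDomain x r; d' = S.isRep⇒inDomain x' r'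
              gx∼gx' = T.∼-trans (proj₂ (φ-isRep x r)) (subst (T._∼ g x') (sym eq) (T.∼-sym (g-dom x' d') (proj₂ (φ-isRep x' r'))))
          in S.isRep-unique x x' r r' (g-reflects x x' d d' gx∼gx')

      T≤S : T.nClasses ≤ S.nClasses
      T≤S = ≤-trans (Unique-⊆⇒length≤ T.decEq repsT (map φ repsS) (filter⁺ _ T.unique) covered) (≤-reflexive (length-map φ repsS))
        where
        covered : ∀ y → y ∈ repsT → y ∈ map φ repsS
        covered y y∈ =
          let ry = proj₂ (∈-filterᵇ⁻ T.isRep T.elements y∈)
              (x , dx , gx∼y) = g-onto y (T.isRep⇒inDomain y ry)
              (rx' , x∼x') = S.rep-isRep x dx
              x' = S.rep x
              dx' = S.isRep⇒inDomain x' rx'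
              (rφ , gx'∼φ) = φ-isRep x' rx'
              φx'∼y = T.∼-trans (T.∼-sym (g-dom x' dx') gx'∼φ) (T.∼-trans (T.∼-sym (g-dom x dx) (g-preserves x x' dx dx' x∼x')) gx∼y)
          in subst (_∈ map φ repsS) (T.isRep-unique (φ x') y rφ ry φx'∼y) (∈-map⁺ φ (∈-filterᵇ⁺ S.isRep (S.∈-elements x' dx') rx'))

  opp-involutive : ∀ {n} (h : Dart n) → opp (opp h) ≡ h
  opp-involutive (e , false) = refl
  opp-involutive (e , true)  = refl

  inA-opp : ∀ {n} (X : Vec Bool n) h → inA X (opp h) ≡ inA X h
  inA-opp X (e , false) = refl
  inA-opp X (e , true)  = refl

  module RestrictedRotation (G : RibbonGraph) (W : WellFormed G) (P : Dart (ne G) → Bool) where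
    open WellFormed W

    σ : Dart (ne G) → Dart (ne G)
    σ z = nextCyc (filterᵇ P (rot G (vertex z))) z

    module AtVertex (u : Fin (nv G)) = RotationSuccessor (rot-unique u)

    σ≡nextIn : ∀ z → P z ≡ true → σ z ≡ AtVertex.nextIn (vertex z) P z
    σ≡nextIn z Pz = nextCyc-filterᵇ P (rot-unique (vertex z)) (∈-rot z) Pz

    σ-∈ : ∀ z → P z ≡ true → σ z ∈ rot G (vertex z)
    σ-∈ z Pz = subst (_∈ rot G (vertex z)) (sym (σ≡nextIn z Pz)) (AtVertex.nextIn-∈ (vertex z) P (∈-rot z) Pz)

    σ-P : ∀ z → P z ≡ true → P (σ z) ≡ true
    σ-P z Pz = subst (λ t → P t ≡ true) (sym (σ≡nextIn z Pz)) (AtVertex.nextIn-B (vertex z) P (∈-rot z) Pz)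

    σ-vertex : ∀ z → P z ≡ true → vertex (σ z) ≡ vertex z
    σ-vertex z Pz = ∈-rot⇒vertex (vertex z) (σ z) (σ-∈ z Pz)

    σ-injective : ∀ z z' → P z ≡ true → P z' ≡ true → σ z ≡ σ z' → z ≡ z'
    σ-injective z z' Pz Pz' eq = AtVertex.nextIn-injective (vertex z) P (∈-rot z) z'∈ Pz Pz'
      (trans (sym (σ≡nextIn z Pz)) (trans eq (trans (σ≡nextIn z' Pz') (cong (λ w → AtVertex.nextIn w P z') (sym same)))))
      where
      same : vertex z ≡ vertex z'
      same = trans (sym (σ-vertex z Pz)) (trans (cong vertex eq) (σ-vertex z' Pz'))
      z'∈ : z' ∈ rot G (vertex z)
      z'∈ = subst (λ w → z' ∈ rot G w) (sym same) (∈-rot z')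

  module Faces (G : RibbonGraph) (W : WellFormed G) (X : State G) where
    open WellFormed W
    open RestrictedRotation G W (inA X) public

    rotA≡σ : ∀ h → rotA G X h ≡ σ h
    rotA≡σ h rewrite vertexOf≡ h = refl

    faceStep≡ : ∀ h → faceStep G X h ≡ σ (opp h)
    faceStep≡ h = rotA≡σ (opp h)

    faceStep-closed : ∀ h → inA X h ≡ true → inA X (faceStep G X h) ≡ true
    faceStep-closed h Xh = subst (λ t → inA X t ≡ true) (sym (faceStep≡ h)) (σ-P (opp h) (trans (inA-opp X h) Xh))

    faceStep-injective : ∀ x y → inA X x ≡ true → inA X y ≡ true → faceStep G X x ≡ faceStep G X y → x ≡ y
    faceStep-injective x y Xx Xy eq = trans (sym (opp-involutive x)) (trans (cong opp opp-eq) (opp-involutive y))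
      where
      opp-eq = σ-injective (opp x) (opp y) (trans (inA-opp X x) Xx) (trans (inA-opp X y) Xy)
                           (trans (sym (faceStep≡ x)) (trans eq (faceStep≡ y)))

    open Orbits (faceStep G X) (inA X) faceStep-closed faceStep-injective public

  -- The classes counted by p.  Which vertices count as isolated is left open: for the
  -- subdivision only the old vertices are matched with those of F.
  module FaceClasses (G : RibbonGraph) (W : WellFormed G) (X : State G) {m : ℕ} (isolated : Fin m → Bool) where
    open Faces G W X

    Item : Set
    Item = Dart (ne G) ⊎ Fin m

    items : List Item
    items = map inj₁ (allDarts (ne G)) ++ map inj₂ (allFin m)

    items-unique : Unique items
    items-unique = Unique-++⁺ (Unique-map⁺ inj₁-injective (Unique-allDarts (ne G))) (Unique-map⁺ inj₂-injective (allFin⁺ m)) disjoint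
      where
      disjoint : ∀ {v} → ¬ (v ∈ map inj₁ (allDarts (ne G)) × v ∈ map inj₂ (allFin m))
      disjoint (v∈₁ , v∈₂) with ∈-map⁻ inj₁ v∈₁ | ∈-map⁻ inj₂ v∈₂
      ... | _ , _ , refl | _ , _ , ()

    inDomain : Item → Bool
    inDomain (inj₁ h) = inA X h
    inDomain (inj₂ u) = isolated u

    _∼_ : Item → Item → Set
    inj₁ h ∼ inj₁ h' = Orbit h h'
    inj₂ u ∼ inj₂ u' = u ≡ u'
    inj₁ _ ∼ inj₂ _  = ⊥
    inj₂ _ ∼ inj₁ _  = ⊥

    ∼-refl : ∀ x → x ∼ x
    ∼-refl (inj₁ h) = Orbit-refl h
    ∼-refl (inj₂ u) = refl

    ∼-sym : ∀ {x y} → inDomain x ≡ true → x ∼ y → y ∼ x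
    ∼-sym {inj₁ _} {inj₁ _} Xh o  = Orbit-sym Xh o
    ∼-sym {inj₂ _} {inj₂ _} _  eq = sym eq

    ∼-trans : ∀ {x y z} → x ∼ y → y ∼ z → x ∼ z
    ∼-trans {inj₁ _} {inj₁ _} {inj₁ _} o o' = Orbit-trans o o'
    ∼-trans {inj₂ _} {inj₂ _} {inj₂ _} e e' = trans e e'

    isRep : Item → Bool
    isRep (inj₁ h) = inA X h ∧ orbitMin (faceStep G X) h
    isRep (inj₂ u) = isolated u

    isRep⇒inDomain : ∀ x → isRep x ≡ true → inDomain x ≡ true
    isRep⇒inDomain (inj₁ h) r = proj₁ (∧≡true⁻ (inA X h) _ r)
    isRep⇒inDomain (inj₂ u) r = r

    isRep-unique : ∀ x y → isRep x ≡ true → isRep y ≡ true → x ∼ y → x ≡ y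
    isRep-unique (inj₁ h) (inj₁ h') r r' o =
      cong inj₁ (orbitMin-unique h h' (proj₁ (∧≡true⁻ (inA X h) _ r)) (proj₂ (∧≡true⁻ (inA X h) _ r)) (proj₂ (∧≡true⁻ (inA X h') _ r')) o)
    isRep-unique (inj₂ u) (inj₂ u') r r' e = cong inj₂ e

    rep : Item → Item
    rep (inj₁ h) = inj₁ (leastInOrbit h)
    rep (inj₂ u) = inj₂ u

    rep-isRep : ∀ x → inDomain x ≡ true → isRep (rep x) ≡ true × x ∼ rep x
    rep-isRep (inj₁ h) Xh = cong₂ _∧_ (Orbit-closed Xh (leastInOrbit-Orbit h)) (leastInOrbit-min h Xh) , leastInOrbit-Orbit h
    rep-isRep (inj₂ u) iso = iso , refl

    ∈-items : ∀ x → inDomain x ≡ true → x ∈ items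
    ∈-items (inj₁ h) _ = ∈-++⁺ˡ (∈-map⁺ inj₁ (∈-allDarts h))
    ∈-items (inj₂ u) _ = ∈-++⁺ʳ (map inj₁ (allDarts (ne G))) (∈-map⁺ inj₂ (∈-allFin u))

    classes : Classes
    classes = record
      { Carrier = Item ; decEq = ⊎-≡-dec _≟D_ _≟F_ ; elements = items ; unique = items-unique
      ; inDomain = inDomain ; _∼_ = _∼_ ; ∼-sym = ∼-sym ; ∼-trans = ∼-trans
      ; isRep = isRep ; isRep⇒inDomain = isRep⇒inDomain ; isRep-unique = isRep-unique
      ; rep = rep ; rep-isRep = rep-isRep ; ∈-elements = ∈-items }

    nClasses≡ : Classes.nClasses classes ≡ count (λ h → inA X h ∧ orbitMin (faceStep G X) h) (allDarts (ne G)) + count isolated (allFin m)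
    nClasses≡ = trans (count-++ isRep (map inj₁ (allDarts (ne G))) (map inj₂ (allFin m)))
                      (cong₂ _+_ (count-map inj₁ isRep (allDarts (ne G))) (count-map inj₂ isRep (allFin m)))

  -- Boundary components of the subdivision

  -- An old dart d of F survives in F' as relabel d when its piece is kept.  The face
  -- permutation of F' alternates between such darts and inner darts at new vertices,
  -- and two of its steps act on old darts as τ.
  module SubdivisionFaces (F : RibbonGraph) (W : WellFormed F) (s₁ s₂ : Vec Bool (ne F)) where
    open WellFormed W
    open Subdivision F W
    open SubdividedState F W s₁ s₂

    kept : Dart E → Bool
    kept (e , false) = lookup s₁ e
    kept (e , true)  = lookup s₂ e

    inA-relabel : ∀ d → inA S' (relabel d) ≡ kept d
    inA-relabel (e , false) = lookup-S'₁ e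
    inA-relabel (e , true)  = lookup-S'₂ e

    filterᵇ-relabel : ∀ l → filterᵇ (inA S') (map relabel l) ≡ map relabel (filterᵇ kept l)
    filterᵇ-relabel []      = refl
    filterᵇ-relabel (d ∷ l) rewrite inA-relabel d with kept d
    ... | true  = cong (relabel d ∷_) (filterᵇ-relabel l)
    ... | false = filterᵇ-relabel l

    module FA  = Faces F W A
    module FS' = Faces F' W' S'
    module K   = RestrictedRotation F W kept

    face : Dart E → Dart E
    face = faceStep F A

    face' : Dart (E + E) → Dart (E + E)
    face' = faceStep F' S'

    rotA'-relabel : ∀ d → rotA F' S' (relabel d) ≡ relabel (K.σ d)
    rotA'-relabel d = begin
      rotA F' S' (relabel d)                                              ≡⟨ FS'.rotA≡σ (relabel d) ⟩
      nextCyc (filterᵇ (inA S') (rot F' (vertex' (relabel d)))) (relabel d) ≡⟨ cong (λ w → nextCyc (filterᵇ (inA S') (rot F' w)) (relabel d)) (vertex'-relabel d) ⟩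
      nextCyc (filterᵇ (inA S') (rot F' (vertex d ↑ˡ E))) (relabel d)       ≡⟨ cong (λ l → nextCyc (filterᵇ (inA S') l) (relabel d)) (rot-old (vertex d)) ⟩
      nextCyc (filterᵇ (inA S') (map relabel (rot F (vertex d)))) (relabel d) ≡⟨ cong (λ l → nextCyc l (relabel d)) (filterᵇ-relabel (rot F (vertex d))) ⟩
      nextCyc (map relabel (filterᵇ kept (rot F (vertex d)))) (relabel d)   ≡⟨ nextCyc-map relabel relabel-injective (filterᵇ kept (rot F (vertex d))) d ⟩
      relabel (K.σ d)                                                      ∎
      where open ≡-Reasoning

    ifPair : Bool → Bool → Dart (E + E) → Dart (E + E) → List (Dart (E + E))
    ifPair x y a b = if x then a ∷ (if y then b ∷ [] else []) else (if y then b ∷ [] else [])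

    keptAtNew : Fin E → List (Dart (E + E))
    keptAtNew e = ifPair (lookup s₁ e) (lookup s₂ e) (inner₁ e) (inner₂ e)

    filterᵇ-newRot : ∀ e → filterᵇ (inA S') (rot F' (V ↑ʳ e)) ≡ keptAtNew e
    filterᵇ-newRot e = trans (cong (filterᵇ (inA S')) (rot-new e))
                             (trans (filterᵇ-pair (inA S') (inner₁ e) (inner₂ e)) (cong₂ (λ x y → ifPair x y (inner₁ e) (inner₂ e)) (lookup-S'₁ e) (lookup-S'₂ e)))
      where
      filterᵇ-pair : (q : Dart (E + E) → Bool) (a b : Dart (E + E)) → filterᵇ q (a ∷ b ∷ []) ≡ ifPair (q a) (q b) a b
      filterᵇ-∷ : (q : Dart (E + E) → Bool) (a : Dart (E + E)) (xs : List (Dart (E + E))) → filterᵇ q (a ∷ xs) ≡ (if q a then a ∷ filterᵇ q xs else filterᵇ q xs)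
      filterᵇ-∷ q a xs with q a
      ... | true  = refl
      ... | false = refl
      filterᵇ-pair q a b = trans (filterᵇ-∷ q a (b ∷ [])) (cong (λ l → if q a then a ∷ l else l) (filterᵇ-∷ q b []))

    rotA'-inner₁ : ∀ e → rotA F' S' (inner₁ e) ≡ nextCyc (keptAtNew e) (inner₁ e)
    rotA'-inner₁ e = trans (FS'.rotA≡σ (inner₁ e)) (trans (cong (λ w → nextCyc (filterᵇ (inA S') (rot F' w)) (inner₁ e)) (vertex'-first e true))
                       (cong (λ l → nextCyc l (inner₁ e)) (filterᵇ-newRot e)))

    rotA'-inner₂ : ∀ e → rotA F' S' (inner₂ e) ≡ nextCyc (keptAtNew e) (inner₂ e)
    rotA'-inner₂ e = trans (FS'.rotA≡σ (inner₂ e)) (trans (cong (λ w → nextCyc (filterᵇ (inA S') (rot F' w)) (inner₂ e)) (vertex'-second e false))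
                       (cong (λ l → nextCyc l (inner₂ e)) (filterᵇ-newRot e)))

    -- Entering a new vertex through a kept piece, the face continues along the
    -- other piece if it is kept and turns back otherwise.
    face'-relabel₁ : ∀ e → lookup s₁ e ≡ true → face' (relabel (e , false)) ≡ (if lookup s₂ e then inner₂ e else inner₁ e)
    face'-relabel₁ e s₁e = trans (rotA'-inner₁ e) turn
      where
      turn : nextCyc (keptAtNew e) (inner₁ e) ≡ (if lookup s₂ e then inner₂ e else inner₁ e)
      turn rewrite s₁e with lookup s₂ e
      ... | true  rewrite ≡⇒isYes _≟D_ {inner₁ e} refl = refl
      ... | false = refl

    face'-relabel₂ : ∀ e → lookup s₂ e ≡ true → face' (relabel (e , true)) ≡ (if lookup s₁ e then inner₁ e else inner₂ e)
    face'-relabel₂ e s₂e = trans (rotA'-inner₂ e) turn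
      where
      turn : nextCyc (keptAtNew e) (inner₂ e) ≡ (if lookup s₁ e then inner₁ e else inner₂ e)
      turn rewrite s₂e with lookup s₁ e
      ... | true  rewrite ≢⇒isNo _≟D_ {inner₁ e} {inner₂ e} (λ eq → ↑ˡ≢↑ʳ e e (cong proj₁ eq)) = refl
      ... | false = refl

    face'-inner₁ : ∀ e → face' (inner₁ e) ≡ relabel (K.σ (e , false))
    face'-inner₁ e = rotA'-relabel (e , false)

    face'-inner₂ : ∀ e → face' (inner₂ e) ≡ relabel (K.σ (e , true))
    face'-inner₂ e = rotA'-relabel (e , true)

    middle : Dart E → Dart (E + E)
    middle d = face' (relabel d)

    τ : Dart E → Dart E
    τ d = if kept (opp d) then K.σ (opp d) else K.σ d

    face'²-relabel : ∀ d → kept d ≡ true → face' (middle d) ≡ relabel (τ d)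
    face'²-relabel (e , false) s₁e with lookup s₂ e in s₂e
    ... | true  = trans (cong face' (trans (face'-relabel₁ e s₁e) (cong (if_then inner₂ e else inner₁ e) s₂e))) (face'-inner₂ e)
    ... | false = trans (cong face' (trans (face'-relabel₁ e s₁e) (cong (if_then inner₂ e else inner₁ e) s₂e))) (face'-inner₁ e)
    face'²-relabel (e , true) s₂e with lookup s₁ e in s₁e
    ... | true  = trans (cong face' (trans (face'-relabel₂ e s₂e) (cong (if_then inner₁ e else inner₂ e) s₁e))) (face'-inner₁ e)
    ... | false = trans (cong face' (trans (face'-relabel₂ e s₂e) (cong (if_then inner₁ e else inner₂ e) s₁e))) (face'-inner₂ e)

    middle-inner : ∀ d → kept d ≡ true → middle d ≡ inner₁ (proj₁ d) ⊎ middle d ≡ inner₂ (proj₁ d)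
    middle-inner (e , false) s₁e with lookup s₂ e in s₂e
    ... | true  = inj₂ (trans (face'-relabel₁ e s₁e) (cong (if_then inner₂ e else inner₁ e) s₂e))
    ... | false = inj₁ (trans (face'-relabel₁ e s₁e) (cong (if_then inner₂ e else inner₁ e) s₂e))
    middle-inner (e , true) s₂e with lookup s₁ e in s₁e
    ... | true  = inj₁ (trans (face'-relabel₂ e s₂e) (cong (if_then inner₁ e else inner₂ e) s₁e))
    ... | false = inj₂ (trans (face'-relabel₂ e s₂e) (cong (if_then inner₁ e else inner₂ e) s₁e))

    middle≢relabel : ∀ d d' → kept d ≡ true → ¬ middle d ≡ relabel d'
    middle≢relabel d d' kd eq with middle-inner d kd
    ... | inj₁ eq₁ = inner₁≢relabel _ d' (trans (sym eq₁) eq)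
    ... | inj₂ eq₂ = inner₂≢relabel _ d' (trans (sym eq₂) eq)

    A⇒kept-both : ∀ d → inA A d ≡ true → kept d ≡ true × kept (opp d) ≡ true
    A⇒kept-both (e , false) Ad = A⇒s₁ Ad , A⇒s₂ Ad
    A⇒kept-both (e , true)  Ad = A⇒s₂ Ad , A⇒s₁ Ad

    A⊆kept : ∀ d → inA A d ≡ true → kept d ≡ true
    A⊆kept d Ad = proj₁ (A⇒kept-both d Ad)

    pendant : ∀ d → kept d ≡ true → inA A d ≡ false → kept (opp d) ≡ false
    pendant (e , false) s₁e Ad with lookup s₂ e in s₂e
    ... | false = refl
    ... | true with () ← trans (sym Ad) (trans (lookup-A e) (cong₂ _∧_ s₁e s₂e))
    pendant (e , true) s₂e Ad with lookup s₁ e in s₁e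
    ... | false = refl
    ... | true with () ← trans (sym Ad) (trans (lookup-A e) (cong₂ _∧_ s₁e s₂e))

    τ-pendant : ∀ d → kept d ≡ true → inA A d ≡ false → τ d ≡ K.σ d
    τ-pendant d kd Ad rewrite pendant d kd Ad = refl

    τ-A : ∀ d → inA A d ≡ true → τ d ≡ K.σ (opp d)
    τ-A d Ad rewrite proj₂ (A⇒kept-both d Ad) = refl

    τ-kept : ∀ d → kept d ≡ true → kept (τ d) ≡ true
    τ-kept d kd with kept (opp d) in ko
    ... | true  = K.σ-P (opp d) ko
    ... | false = K.σ-P d kd

    iter-τ-kept : ∀ k d → kept d ≡ true → kept (iter τ k d) ≡ true
    iter-τ-kept zero    d kd = kd
    iter-τ-kept (suc k) d kd = τ-kept (iter τ k d) (iter-τ-kept k d kd)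

    face'-even : ∀ k d → kept d ≡ true → iter face' (k + k) (relabel d) ≡ relabel (iter τ k d)
    face'-even zero    d kd = refl
    face'-even (suc k) d kd = trans (cong (λ t → iter face' t (relabel d)) (cong suc (+-suc k k)))
      (trans (cong (λ t → face' (face' t)) (face'-even k d kd)) (face'²-relabel (iter τ k d) (iter-τ-kept k d kd)))

    half : ∀ i → ∃ λ k → i ≡ k + k ⊎ i ≡ suc (k + k)
    half zero = 0 , inj₁ refl
    half (suc i) with half i
    ... | k , inj₁ eq = k , inj₂ (cong suc eq)
    ... | k , inj₂ eq = suc k , inj₁ (trans (cong suc eq) (cong suc (sym (+-suc k k))))

    Orbit'⇒τ : ∀ d d' → kept d ≡ true → FS'.Orbit (relabel d) (relabel d') → ∃ λ k → iter τ k d ≡ d'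
    Orbit'⇒τ d d' kd (i , eq) with half i
    ... | k , inj₁ refl = k , relabel-injective (trans (sym (face'-even k d kd)) eq)
    ... | k , inj₂ refl = ⊥-elim (middle≢relabel (iter τ k d) d' (iter-τ-kept k d kd) (trans (cong face' (sym (face'-even k d kd))) eq))

    τ⇒Orbit' : ∀ d k → kept d ≡ true → FS'.Orbit (relabel d) (relabel (iter τ k d))
    τ⇒Orbit' d k kd = k + k , face'-even k d kd

  firstWith-fromMaybe : {A : Set} (P : A → Bool) {l : List A} {w : A} (d : A) → w ∈ l → P w ≡ true →
                        firstWith P l ≡ just (fromMaybe d (firstWith P l))
  firstWith-fromMaybe P d w∈ Pw with firstWith-just⁺ P w∈ Pw
  ... | y , eq rewrite eq = refl

  module SubdivisionWalks (F : RibbonGraph) (W : WellFormed F) (s₁ s₂ : Vec Bool (ne F)) where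
    open WellFormed W
    open Subdivision F W
    open SubdividedState F W s₁ s₂
    open SubdivisionFaces F W s₁ s₂

    module AtVertex (u : Fin V) = RotationSuccessor (rot-unique u)

    cycleAt : Dart E → List (Dart E)
    cycleAt z = cycleAfter (rot F (vertex z)) z

    firstA-σ : ∀ z → inA A z ≡ true → firstWith (inA A) (cycleAt z) ≡ just (FA.σ z)
    firstA-σ z Az = trans (firstWith-fromMaybe (inA A) z (∈-cycleAfter⁺ (rot-unique (vertex z)) (∈-rot z) (∈-rot z)) Az)
                          (cong just (sym (FA.σ≡nextIn z Az)))

    τ≡nextIn : ∀ u w → w ∈ rot F u → kept w ≡ true → inA A w ≡ false → τ w ≡ AtVertex.nextIn u kept w
    τ≡nextIn u w w∈ kw Aw = trans (τ-pendant w kw Aw) (trans (K.σ≡nextIn w kw) (cong (λ v → AtVertex.nextIn v kept w) (∈-rot⇒vertex u w w∈)))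

    Reach : Dart E → Dart E → Set
    Reach x y = ∃ λ k → iter τ k x ≡ y

    Reach-trans : ∀ {x y z} → Reach x y → Reach y z → Reach x z
    Reach-trans {x} (i , refl) (j , refl) = j + i , iter-+ τ j i x

    pendant-reaches-A : ∀ y t → kept y ≡ true → inA A y ≡ false → firstWith (inA A) (cycleAt y) ≡ just t → Reach y t
    pendant-reaches-A y t ky Ay firstA =
      AtVertex.walk (vertex y) (inA A) kept A⊆kept τ (τ≡nextIn (vertex y)) (∈-rot y) ky Ay firstA

    firstA-next : ∀ w → kept w ≡ true → inA A (K.σ w) ≡ true → firstWith (inA A) (cycleAt w) ≡ just (K.σ w)
    firstA-next w kw Ay = trans (AtVertex.firstWith-nextIn-A (vertex w) (inA A) kept A⊆kept (∈-rot w) kw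
                                   (trans (cong (inA A) (sym (K.σ≡nextIn w kw))) Ay))
                                (cong just (sym (K.σ≡nextIn w kw)))

    firstA-skip : ∀ w → kept w ≡ true → inA A (K.σ w) ≡ false → firstWith (inA A) (cycleAt (K.σ w)) ≡ firstWith (inA A) (cycleAt w)
    firstA-skip w kw Ay = trans (cong (firstWith (inA A)) (cong₂ (λ v y → cycleAfter (rot F v) y) (K.σ-vertex w kw) (K.σ≡nextIn w kw)))
                                (AtVertex.firstWith-nextIn-¬A (vertex w) (inA A) kept A⊆kept (∈-rot w) kw
                                   (trans (cong (inA A) (sym (K.σ≡nextIn w kw))) Ay))

    opp-A : ∀ {h} → inA A h ≡ true → inA A (opp h) ≡ true
    opp-A {h} Ah = trans (inA-opp A h) Ah

    face≡τ : ∀ h → inA A h ≡ true → inA A (K.σ (opp h)) ≡ true → face h ≡ τ h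
    face≡τ h Ah Ay = trans (FA.faceStep≡ h) (trans (just-injective (trans (sym (firstA-σ (opp h) (opp-A {h} Ah))) (firstA-next (opp h) (A⊆kept (opp h) (opp-A {h} Ah)) Ay)))
                                                   (sym (τ-A h Ah)))

    firstA-after-A : ∀ h → inA A h ≡ true → inA A (K.σ (opp h)) ≡ false → firstWith (inA A) (cycleAt (τ h)) ≡ just (face h)
    firstA-after-A h Ah Ay = trans (cong (firstWith (inA A) ∘ cycleAt) (τ-A h Ah))
      (trans (firstA-skip (opp h) (A⊆kept (opp h) (opp-A {h} Ah)) Ay) (trans (firstA-σ (opp h) (opp-A {h} Ah)) (cong just (sym (FA.faceStep≡ h)))))

    -- τ turns at the A-dart h into the pendant darts after opp h, then walks on to face h
    face-Reach : ∀ h → inA A h ≡ true → Reach h (face h)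
    face-Reach h Ah with inA A (K.σ (opp h)) in Ay
    ... | true  = 1 , sym (face≡τ h Ah Ay)
    ... | false = Reach-trans (1 , refl) (pendant-reaches-A (τ h) (face h) (τ-kept h (A⊆kept h Ah))
                                            (trans (cong (inA A) (τ-A h Ah)) Ay) (firstA-after-A h Ah Ay))

    -- From an A-dart h, τ only meets darts of the A-face of h, or pendant darts whose
    -- next A-dart around their vertex lies on that face.
    Tracked : Dart E → Dart E → Set
    Tracked h x = (inA A x ≡ true × FA.Orbit h x) ⊎
                  (kept x ≡ true × inA A x ≡ false × ∃ λ t → firstWith (inA A) (cycleAt x) ≡ just t × FA.Orbit h t)

    Tracked-τ : ∀ h x → Tracked h x → Tracked h (τ x)
    Tracked-τ h x (inj₁ (Ax , o)) with inA A (K.σ (opp x)) in Ay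
    ... | true  = inj₁ (trans (cong (inA A) (τ-A x Ax)) Ay , FA.Orbit-trans o (subst (FA.Orbit x) (face≡τ x Ax Ay) (FA.Orbit-step x)))
    ... | false = inj₂ (τ-kept x (A⊆kept x Ax) , trans (cong (inA A) (τ-A x Ax)) Ay , face x , firstA-after-A x Ax Ay ,
                        FA.Orbit-trans o (FA.Orbit-step x))
    Tracked-τ h x (inj₂ (kx , Ax , t , firstA , o)) with inA A (K.σ x) in Ay
    ... | true  = inj₁ (trans (cong (inA A) (τ-pendant x kx Ax)) Ay ,
                        subst (FA.Orbit h) (trans (just-injective (trans (sym firstA) (firstA-next x kx Ay))) (sym (τ-pendant x kx Ax))) o)
    ... | false = inj₂ (τ-kept x kx , trans (cong (inA A) (τ-pendant x kx Ax)) Ay , t ,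
                        trans (cong (firstWith (inA A) ∘ cycleAt) (τ-pendant x kx Ax)) (trans (firstA-skip x kx Ay) firstA) , o)

    Tracked-iter : ∀ h → inA A h ≡ true → ∀ k → Tracked h (iter τ k h)
    Tracked-iter h Ah zero    = inj₁ (Ah , FA.Orbit-refl h)
    Tracked-iter h Ah (suc k) = Tracked-τ h _ (Tracked-iter h Ah k)

    Reach⇒Orbit : ∀ h h' → inA A h ≡ true → inA A h' ≡ true → Reach h h' → FA.Orbit h h'
    Reach⇒Orbit h h' Ah Ah' (k , eq) with Tracked-iter h Ah k
    ... | inj₁ (_ , o) = subst (FA.Orbit h) eq o
    ... | inj₂ (_ , Ak , _) with () ← trans (sym Ak) (trans (cong (inA A) eq) Ah')

    Orbit⇒Reach : ∀ h h' → inA A h ≡ true → FA.Orbit h h' → Reach h h'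
    Orbit⇒Reach h h' Ah (i , refl) = go i
      where
      go : ∀ i → Reach h (iter face i h)
      go zero    = 0 , refl
      go (suc i) = Reach-trans (go i) (face-Reach (iter face i h) (FA.iter-closed i h Ah))

    Bare : Fin V → Set
    Bare u = ∀ w → w ∈ rot F u → inA A w ≡ false

    τ-stays : ∀ u → Bare u → ∀ k x → kept x ≡ true → vertex x ≡ u → kept (iter τ k x) ≡ true × vertex (iter τ k x) ≡ u
    τ-stays u bare zero    x kx ux = kx , ux
    τ-stays u bare (suc k) x kx ux with τ-stays u bare k x kx ux
    ... | ky , uy = τ-kept y ky , trans (cong vertex (τ-pendant y ky (bare y (subst (λ v → y ∈ rot F v) uy (∈-rot y))))) (trans (K.σ-vertex y ky) uy)
      where y = iter τ k x

    τ-tours : ∀ u → Bare u → ∀ y t → kept y ≡ true → vertex y ≡ u → t ∈ rot F u → kept t ≡ true → Reach y t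
    τ-tours u bare y t ky uy t∈ kt with y ≟D t
    ... | yes y≡t = 0 , y≡t
    ... | no y≢t  = AtVertex.walk u (λ w → ⌊ w ≟D t ⌋) kept is-t⇒kept τ τ≡next y∈ ky (≢⇒isNo _≟D_ y≢t)
                      (firstWith-unique (λ w → ⌊ w ≟D t ⌋) (∈-cycleAfter⁺ (rot-unique u) y∈ t∈) (≡⇒isYes _≟D_ refl)
                                        (λ w _ eq → isYes⇒≡ _≟D_ w t eq))
      where
      y∈ : y ∈ rot F u
      y∈ = subst (λ v → y ∈ rot F v) uy (∈-rot y)
      is-t⇒kept : ∀ w → ⌊ w ≟D t ⌋ ≡ true → kept w ≡ true
      is-t⇒kept w eq = subst (λ v → kept v ≡ true) (sym (isYes⇒≡ _≟D_ w t eq)) kt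
      τ≡next : ∀ w → w ∈ rot F u → kept w ≡ true → ⌊ w ≟D t ⌋ ≡ false → τ w ≡ AtVertex.nextIn u kept w
      τ≡next w w∈ kw _ = τ≡nextIn u w w∈ kw (bare w w∈)

  module _ {A : Set} (q : A → Bool) where

    null-filterᵇ⁻ : ∀ l → null (filterᵇ q l) ≡ true → ∀ w → w ∈ l → q w ≡ false
    null-filterᵇ⁻ (x ∷ l) h w w∈ with q x in qx
    null-filterᵇ⁻ (x ∷ l) () w w∈ | true
    null-filterᵇ⁻ (x ∷ l) h w (here refl) | false = qx
    null-filterᵇ⁻ (x ∷ l) h w (there w∈) | false = null-filterᵇ⁻ l h w w∈

    null-filterᵇ⁺ : ∀ l → (∀ w → w ∈ l → q w ≡ false) → null (filterᵇ q l) ≡ true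
    null-filterᵇ⁺ []      none = refl
    null-filterᵇ⁺ (x ∷ l) none rewrite none x (here refl) = null-filterᵇ⁺ l (λ w w∈ → none w (there w∈))

    null-filterᵇ-false : ∀ {l w} → w ∈ l → q w ≡ true → null (filterᵇ q l) ≡ false
    null-filterᵇ-false {l} w∈ qw with filterᵇ q l in eq
    ... | []    with () ← subst (_ ∈_) eq (∈-filterᵇ⁺ q w∈ qw)
    ... | _ ∷ _ = refl

  null-map : {A B : Set} (g : A → B) (l : List A) → null (map g l) ≡ null l
  null-map g []      = refl
  null-map g (_ ∷ _) = refl

  -- Matching the boundary components of S' with those of A: a face of A is sent to
  -- the face of S' through its relabelled darts, and an isolated vertex of A to the
  -- face around its pendant pieces if it has any.
  module SubdivisionBoundaries (F : RibbonGraph) (W : WellFormed F) (s₁ s₂ : Vec Bool (ne F)) where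
    open WellFormed W
    open Subdivision F W
    open SubdividedState F W s₁ s₂
    open SubdivisionFaces F W s₁ s₂
    open SubdivisionWalks F W s₁ s₂

    isolatedA : Fin V → Bool
    isolatedA u = null (filterᵇ (inA A) (rot F u))

    isolatedS' : Fin V → Bool
    isolatedS' u = null (filterᵇ (inA S') (rot F' (u ↑ˡ E)))

    module CA  = FaceClasses F W A isolatedA
    module CS' = FaceClasses F' W' S' isolatedS'

    isolatedS'≡ : ∀ u → isolatedS' u ≡ null (filterᵇ kept (rot F u))
    isolatedS'≡ u = trans (cong (λ l → null (filterᵇ (inA S') l)) (rot-old u))
                          (trans (cong null (filterᵇ-relabel (rot F u))) (null-map relabel (filterᵇ kept (rot F u))))

    toItem : CA.Item → CS'.Item
    toItem (inj₁ h) = inj₁ (relabel h)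
    toItem (inj₂ u) = maybe (inj₁ ∘ relabel) (inj₂ u) (firstWith kept (rot F u))

    VertexView : Fin V → Set
    VertexView u = (∀ w → w ∈ rot F u → kept w ≡ false) × toItem (inj₂ u) ≡ inj₂ u
                 ⊎ Σ (Dart E) λ d → d ∈ rot F u × kept d ≡ true × toItem (inj₂ u) ≡ inj₁ (relabel d)

    vertexView : ∀ u → VertexView u
    vertexView u with firstWith kept (rot F u) in eq
    ... | nothing = inj₁ (firstWith-nothing⁻ kept (rot F u) eq , refl)
    ... | just d  = let (d∈ , kd) = firstWith-just⁻ kept (rot F u) eq in inj₂ (d , d∈ , kd , refl)

    noKept⇒isolatedA : ∀ u → (∀ w → w ∈ rot F u → kept w ≡ false) → isolatedA u ≡ true
    noKept⇒isolatedA u none = null-filterᵇ⁺ (inA A) (rot F u) λ w w∈ → ¬-not λ Aw → case trans (sym (none w w∈)) (A⊆kept w Aw) of λ ()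

    toItem-dom : ∀ x → CA.inDomain x ≡ true → CS'.inDomain (toItem x) ≡ true
    toItem-dom (inj₁ h) Ah = trans (inA-relabel h) (A⊆kept h Ah)
    toItem-dom (inj₂ u) _ with vertexView u
    ... | inj₁ (none , eq) rewrite eq = trans (isolatedS'≡ u) (null-filterᵇ⁺ kept (rot F u) none)
    ... | inj₂ (d , _ , kd , eq) rewrite eq = trans (inA-relabel d) kd

    Reach⇒Orbit' : ∀ d d' → kept d ≡ true → Reach d d' → FS'.Orbit (relabel d) (relabel d')
    Reach⇒Orbit' d d' kd (k , eq) = subst (λ t → FS'.Orbit (relabel d) (relabel t)) eq (τ⇒Orbit' d k kd)

    A↛Bare : ∀ h u d → inA A h ≡ true → Bare u → d ∈ rot F u → Reach h d → ⊥
    A↛Bare h u d Ah bare d∈ (k , eq) with Tracked-iter h Ah k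
    ... | inj₁ (Ak , _) with () ← trans (sym (bare d d∈)) (trans (cong (inA A) (sym eq)) Ak)
    ... | inj₂ (_ , _ , t , firstA , _) with firstWith-just⁻ (inA A) (cycleAt (iter τ k h)) firstA
    ... | t∈ , At with () ← trans (sym (bare t (subst (λ v → t ∈ rot F v) (trans (cong vertex eq) (∈-rot⇒vertex u d d∈))
                                                    (∈-cycleAfter⁻ (rot-unique _) (∈-rot _) t∈)))) At

    Bare↛A : ∀ u d h → Bare u → d ∈ rot F u → kept d ≡ true → inA A h ≡ true → Reach d h → ⊥
    Bare↛A u d h bare d∈ kd Ah (k , eq) with τ-stays u bare k d kd (∈-rot⇒vertex u d d∈)
    ... | _ , uk with () ← trans (sym (bare h (subst (λ v → h ∈ rot F v) (trans (cong vertex (sym eq)) uk) (∈-rot h)))) Ah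

    toItem-reflects : ∀ x x' → CA.inDomain x ≡ true → CA.inDomain x' ≡ true → toItem x CS'.∼ toItem x' → x CA.∼ x'
    toItem-reflects (inj₁ h) (inj₁ h') Ah Ah' o = Reach⇒Orbit h h' Ah Ah' (Orbit'⇒τ h h' (A⊆kept h Ah) o)
    toItem-reflects (inj₁ h) (inj₂ u') Ah iso' o with vertexView u'
    ... | inj₁ (_ , eq) rewrite eq = o
    ... | inj₂ (d , d∈ , _ , eq) rewrite eq = A↛Bare h u' d Ah (null-filterᵇ⁻ (inA A) _ iso') d∈ (Orbit'⇒τ h d (A⊆kept h Ah) o)
    toItem-reflects (inj₂ u) (inj₁ h') iso Ah' o with vertexView u
    ... | inj₁ (_ , eq) rewrite eq = o
    ... | inj₂ (d , d∈ , kd , eq) rewrite eq = Bare↛A u d h' (null-filterᵇ⁻ (inA A) _ iso) d∈ kd Ah' (Orbit'⇒τ d h' kd o)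
    toItem-reflects (inj₂ u) (inj₂ u') iso iso' o with vertexView u | vertexView u'
    ... | inj₁ (_ , eq) | inj₁ (_ , eq') rewrite eq | eq' = o
    ... | inj₁ (_ , eq) | inj₂ (_ , _ , _ , eq') rewrite eq | eq' = ⊥-elim o
    ... | inj₂ (_ , _ , _ , eq) | inj₁ (_ , eq') rewrite eq | eq' = ⊥-elim o
    ... | inj₂ (d , d∈ , kd , eq) | inj₂ (d' , d'∈ , _ , eq') rewrite eq | eq' with Orbit'⇒τ d d' kd o
    ... | k , reached = trans (sym (proj₂ (τ-stays u (null-filterᵇ⁻ (inA A) _ iso) k d kd (∈-rot⇒vertex u d d∈))))
                              (trans (cong vertex reached) (∈-rot⇒vertex u' d' d'∈))

    toItem-preserves : ∀ x x' → CA.inDomain x ≡ true → CA.inDomain x' ≡ true → x CA.∼ x' → toItem x CS'.∼ toItem x'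
    toItem-preserves (inj₁ h) (inj₁ h') Ah _ o = Reach⇒Orbit' h h' (A⊆kept h Ah) (Orbit⇒Reach h h' Ah o)
    toItem-preserves (inj₂ u) (inj₂ .u) _ _ refl = CS'.∼-refl (toItem (inj₂ u))

    kept-covered : ∀ d → kept d ≡ true → ∃ λ x → CA.inDomain x ≡ true × toItem x CS'.∼ inj₁ (relabel d)
    kept-covered d kd with inA A d in Ad
    ... | true = inj₁ d , Ad , FS'.Orbit-refl (relabel d)
    ... | false with firstWith (inA A) (cycleAt d) in firstA
    ... | just t = inj₁ t , proj₂ (firstWith-just⁻ (inA A) (cycleAt d) firstA) ,
                   FS'.Orbit-sym (trans (inA-relabel d) kd) (Reach⇒Orbit' d t kd (pendant-reaches-A d t kd Ad firstA))
    ... | nothing = inj₂ u , noA⇒isolated , around (vertexView u)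
      where
      u = vertex d
      bare : Bare u
      bare w w∈ = firstWith-nothing⁻ (inA A) (cycleAt d) firstA w (∈-cycleAfter⁺ (rot-unique u) (∈-rot d) w∈)
      noA⇒isolated : isolatedA u ≡ true
      noA⇒isolated = null-filterᵇ⁺ (inA A) (rot F u) bare
      around : VertexView u → toItem (inj₂ u) CS'.∼ inj₁ (relabel d)
      around (inj₁ (none , _)) with () ← trans (sym (none d (∈-rot d))) kd
      around (inj₂ (d₀ , d₀∈ , kd₀ , eq)) rewrite eq =
        FS'.Orbit-sym (trans (inA-relabel d) kd) (Reach⇒Orbit' d d₀ kd (τ-tours u bare d d₀ kd refl d₀∈ kd₀))

    toItem-onto : ∀ y → CS'.inDomain y ≡ true → ∃ λ x → CA.inDomain x ≡ true × toItem x CS'.∼ y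
    toItem-onto (inj₁ h) S'h = go (dartView h) S'h
      where
      go : ∀ {h} → DartView h → inA S' h ≡ true → ∃ λ x → CA.inDomain x ≡ true × toItem x CS'.∼ inj₁ h
      go (first e false)  S'h = kept-covered (e , false) (trans (sym (lookup-S'₁ e)) S'h)
      go (second e true)  S'h = kept-covered (e , true) (trans (sym (lookup-S'₂ e)) S'h)
      go (first e true)   S'h =
        let (x , dx , o) = kept-covered (K.σ (e , false)) (K.σ-P (e , false) (trans (sym (lookup-S'₁ e)) S'h))
        in x , dx , CS'.∼-trans {toItem x} {inj₁ (relabel (K.σ (e , false)))} {inj₁ (inner₁ e)} o
                      (FS'.Orbit-sym S'h (subst (FS'.Orbit (inner₁ e)) (face'-inner₁ e) (FS'.Orbit-step (inner₁ e))))
      go (second e false) S'h =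
        let (x , dx , o) = kept-covered (K.σ (e , true)) (K.σ-P (e , true) (trans (sym (lookup-S'₂ e)) S'h))
        in x , dx , CS'.∼-trans {toItem x} {inj₁ (relabel (K.σ (e , true)))} {inj₁ (inner₂ e)} o
                      (FS'.Orbit-sym S'h (subst (FS'.Orbit (inner₂ e)) (face'-inner₂ e) (FS'.Orbit-step (inner₂ e))))
    toItem-onto (inj₂ u) iso' with vertexView u
    ... | inj₁ (none , eq) = inj₂ u , noKept⇒isolatedA u none , subst (CS'._∼ inj₂ u) (sym eq) refl
    ... | inj₂ (d , d∈ , kd , _) with () ← trans (sym iso') (trans (isolatedS'≡ u) (null-filterᵇ-false kept d∈ kd))

    isolatedNew : ∀ e → null (filterᵇ (inA S') (rot F' (V ↑ʳ e))) ≡ neither (lookup s₁ e) (lookup s₂ e)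
    isolatedNew e = trans (cong null (filterᵇ-newRot e)) (null-ifPair (lookup s₁ e) (lookup s₂ e))
      where
      null-ifPair : ∀ a b → null (ifPair a b (inner₁ e) (inner₂ e)) ≡ neither a b
      null-ifPair true  b     = refl
      null-ifPair false true  = refl
      null-ifPair false false = refl

    p-subdivision : p F' S' ≡ p F A + nNeither
    p-subdivision = begin
      p F' S'                                          ≡⟨ cong (count (λ h → inA S' h ∧ orbitMin face' h) (allDarts (E + E)) +_)
                                                            (count-allFin-+ V E (λ w → null (filterᵇ (inA S') (rot F' w)))) ⟩
      nFaces' + (count isolatedS' (allFin V) + count (λ e → null (filterᵇ (inA S') (rot F' (V ↑ʳ e)))) (allFin E))
                                                       ≡⟨ cong (λ c → nFaces' + (count isolatedS' (allFin V) + c)) (trans (count-cong _ _ (allFin E) (λ e _ → trans (isolatedNew e) (sym (lookup-zipWith neither e s₁ s₂)))) (count-lookup (zipWith neither s₁ s₂))) ⟩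
      nFaces' + (count isolatedS' (allFin V) + nNeither) ≡⟨ +-assoc nFaces' _ nNeither ⟨
      (nFaces' + count isolatedS' (allFin V)) + nNeither ≡⟨ cong (_+ nNeither) CS'.nClasses≡ ⟨
      Classes.nClasses CS'.classes + nNeither           ≡⟨ cong (_+ nNeither) (nClasses-≡ CA.classes CS'.classes toItem toItem-dom toItem-reflects toItem-preserves toItem-onto) ⟨
      Classes.nClasses CA.classes + nNeither            ≡⟨ cong (_+ nNeither) CA.nClasses≡ ⟩
      p F A + nNeither                                  ∎
      where
      open ≡-Reasoning
      nFaces' = count (λ h → inA S' h ∧ orbitMin face' h) (allDarts (E + E))

  -- Exponents of a state

  countTrue-++ : ∀ {m n} (xs : Vec Bool m) (ys : Vec Bool n) → countTrue (xs ++ᵛ ys) ≡ countTrue xs + countTrue ys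
  countTrue-++ []          ys = refl
  countTrue-++ (true ∷ xs) ys = cong suc (countTrue-++ xs ys)
  countTrue-++ (false ∷ xs) ys = countTrue-++ xs ys

  countTrue-replicate : ∀ n → countTrue (replicate n true) ≡ n
  countTrue-replicate zero    = refl
  countTrue-replicate (suc n) = cong suc (countTrue-replicate n)

  countTrue-map-not : ∀ {n} (A : Vec Bool n) → countTrue (Vec.map not A) + countTrue A ≡ n
  countTrue-map-not []          = refl
  countTrue-map-not (true ∷ A)  = trans (+-suc _ (countTrue A)) (cong suc (countTrue-map-not A))
  countTrue-map-not (false ∷ A) = cong suc (countTrue-map-not A)

  -- each edge contributes 2 + 0 = 1 + 1, 1 + 0 = 0 + 1 or 0 + 1 = 0 + 1
  countTrue-pieces : ∀ {n} (s₁ s₂ : Vec Bool n) →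
    countTrue s₁ + countTrue s₂ + countTrue (zipWith neither s₁ s₂) ≡ countTrue (zipWith _∧_ s₁ s₂) + n
  countTrue-pieces []       []       = refl
  countTrue-pieces {suc n} (x ∷ s₁) (y ∷ s₂) = edge x y
    where
    c₁ = countTrue s₁
    c₂ = countTrue s₂
    a  = countTrue (zipWith neither s₁ s₂)
    cA = countTrue (zipWith _∧_ s₁ s₂)
    ih = countTrue-pieces s₁ s₂
    edge : ∀ x y → countTrue (x ∷ s₁) + countTrue (y ∷ s₂) + countTrue (neither x y ∷ zipWith neither s₁ s₂)
                   ≡ countTrue ((x ∧ y) ∷ zipWith _∧_ s₁ s₂) + suc n
    edge true  true  = cong suc (trans (cong (_+ a) (+-suc c₁ c₂)) (trans (cong suc ih) (sym (+-suc cA n))))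
    edge true  false = trans (cong suc ih) (sym (+-suc cA n))
    edge false true  = trans (cong (_+ a) (+-suc c₁ c₂)) (trans (cong suc ih) (sym (+-suc cA n)))
    edge false false = trans (+-suc (c₁ + c₂) a) (trans (cong suc ih) (sym (+-suc cA n)))

  replicate-++ : ∀ {A : Set} m n (x : A) → replicate (m + n) x ≡ replicate m x ++ᵛ replicate n x
  replicate-++ zero    n x = refl
  replicate-++ (suc m) n x = cong (x ∷_) (replicate-++ m n x)

  countTrue-neither-full : ∀ n → countTrue (zipWith neither (replicate n true) (replicate n true)) ≡ 0
  countTrue-neither-full zero    = refl
  countTrue-neither-full (suc n) = countTrue-neither-full n

  ∸-∸-flip : ∀ {a b m} → a ≤ b → b ≤ m → (m ∸ a) ∸ (m ∸ b) ≡ b ∸ a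
  ∸-∸-flip {a} {b} {m} a≤b b≤m = begin
    (m ∸ a) ∸ (m ∸ b)                       ≡⟨ cong (λ t → (t ∸ a) ∸ (m ∸ b)) split ⟩
    ((m ∸ b) + (b ∸ a) + a) ∸ a ∸ (m ∸ b)   ≡⟨ cong (_∸ (m ∸ b)) (m+n∸n≡m ((m ∸ b) + (b ∸ a)) a) ⟩
    ((m ∸ b) + (b ∸ a)) ∸ (m ∸ b)           ≡⟨ m+n∸m≡n (m ∸ b) (b ∸ a) ⟩
    b ∸ a                                   ∎
    where
    open ≡-Reasoning
    split : m ≡ (m ∸ b) + (b ∸ a) + a
    split = sym (trans (+-assoc (m ∸ b) (b ∸ a) a) (trans (cong ((m ∸ b) +_) (m∸n+n≡m a≤b)) (m∸n+n≡m b≤m)))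

  module StateExponents (F : RibbonGraph) (W : WellFormed F) (A : State F) where
    open Components F W

    kF kA : ℕ
    kF = k F (fullState F)
    kA = k F A

    kF≤kA : kF ≤ kA
    kF≤kA = k-antitone A (fullState F) (λ e _ → lookup-replicate e true)

    corank≡ : rG F ∸ r F A ≡ kA ∸ kF
    corank≡ = ∸-∸-flip kF≤kA (k≤nv A)

    -- (E + kF − V) + (kA − kF) = (E − e(A)) + (e(A) + kA − V), checked after adding V
    nullity-shift : nG F + (rG F ∸ r F A) ≡ countTrue (Vec.map not A) + n F A
    nullity-shift = +-cancelʳ-≡ (nv F) _ _ (trans lhs (sym rhs))
      where
      open ≡-Reasoning
      E = ne F
      V = nv F
      V≤E+kF : V ≤ E + kF
      V≤E+kF = subst (λ c → V ≤ c + kF) (countTrue-replicate E) (nv≤e+k (fullState F))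
      lhs : nG F + (rG F ∸ r F A) + V ≡ E + kA
      lhs = begin
        nG F + (rG F ∸ r F A) + V            ≡⟨ cong (λ t → ((countTrue (fullState F) + kF) ∸ V) + t + V) corank≡ ⟩
        ((countTrue (fullState F) + kF) ∸ V) + (kA ∸ kF) + V ≡⟨ cong (λ c → ((c + kF) ∸ V) + (kA ∸ kF) + V) (countTrue-replicate E) ⟩
        ((E + kF) ∸ V) + (kA ∸ kF) + V        ≡⟨ +-comm _ V ⟩
        V + ((E + kF) ∸ V + (kA ∸ kF))        ≡⟨ +-assoc V _ _ ⟨
        V + ((E + kF) ∸ V) + (kA ∸ kF)        ≡⟨ cong (_+ (kA ∸ kF)) (m+[n∸m]≡n V≤E+kF) ⟩
        E + kF + (kA ∸ kF)                    ≡⟨ +-assoc E kF _ ⟩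
        E + (kF + (kA ∸ kF))                  ≡⟨ cong (E +_) (m+[n∸m]≡n kF≤kA) ⟩
        E + kA                                ∎
      rhs : countTrue (Vec.map not A) + n F A + V ≡ E + kA
      rhs = begin
        countTrue (Vec.map not A) + n F A + V           ≡⟨ +-assoc _ (n F A) V ⟩
        countTrue (Vec.map not A) + (n F A + V)         ≡⟨ cong (countTrue (Vec.map not A) +_) (m∸n+n≡m (nv≤e+k A)) ⟩
        countTrue (Vec.map not A) + (countTrue A + kA)  ≡⟨ +-assoc _ (countTrue A) kA ⟨
        countTrue (Vec.map not A) + countTrue A + kA    ≡⟨ cong (_+ kA) (countTrue-map-not A) ⟩
        E + kA                                          ∎

  module SubdivisionExponents (F : RibbonGraph) (W : WellFormed F) (s₁ s₂ : Vec Bool (ne F)) where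
    open Subdivision F W
    open SubdividedState F W s₁ s₂
    open StateExponents F W A
    module C' = Components F' W'

    kS' : k F' S' ≡ kA + nNeither
    kS' = SubdivisionComponents.k-subdivision F W s₁ s₂

    k-full' : k F' (fullState F') ≡ kF
    k-full' = begin
      k F' (replicate (E + E) true)                                        ≡⟨ cong (k F') (replicate-++ E E true) ⟩
      k F' (full ++ᵛ full)                                                 ≡⟨ SubdivisionComponents.k-subdivision F W full full ⟩
      k F (zipWith _∧_ full full) + countTrue (zipWith neither full full)  ≡⟨ cong₂ _+_ (cong (k F) (zipWith-replicate _∧_ true true))
                                                                                        (countTrue-neither-full E) ⟩
      kF + 0                                                               ≡⟨ +-identityʳ kF ⟩
      kF                                                                   ∎
      where
      open ≡-Reasoning
      full = replicate E true

    corank-subdivision : rG F' ∸ r F' S' ≡ (rG F ∸ r F A) + nNeither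
    corank-subdivision = begin
      ((V + E) ∸ k F' (fullState F')) ∸ ((V + E) ∸ k F' S') ≡⟨ cong₂ (λ a b → ((V + E) ∸ a) ∸ ((V + E) ∸ b)) k-full' kS' ⟩
      ((V + E) ∸ kF) ∸ ((V + E) ∸ (kA + nNeither))         ≡⟨ ∸-∸-flip (≤-trans kF≤kA (m≤m+n kA nNeither)) (subst (_≤ V + E) kS' (C'.k≤nv S')) ⟩
      (kA + nNeither) ∸ kF                                 ≡⟨ +-∸-comm nNeither kF≤kA ⟩
      (kA ∸ kF) + nNeither                                 ≡⟨ cong (_+ nNeither) corank≡ ⟨
      (rG F ∸ r F A) + nNeither                            ∎
      where open ≡-Reasoning

    nullity-subdivision : n F' S' ≡ n F A
    nullity-subdivision = begin
      (countTrue S' + k F' S') ∸ (V + E)                                 ≡⟨ cong₂ (λ c k' → (c + k') ∸ (V + E)) (countTrue-++ s₁ s₂) kS' ⟩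
      (countTrue s₁ + countTrue s₂ + (kA + nNeither)) ∸ (V + E)          ≡⟨ cong₂ _∸_ regroup (+-comm V E) ⟩
      (E + (countTrue A + kA)) ∸ (E + V)                                 ≡⟨ [m+n]∸[m+o]≡n∸o E (countTrue A + kA) V ⟩
      (countTrue A + kA) ∸ V                                             ∎
      where
      open ≡-Reasoning
      regroup : countTrue s₁ + countTrue s₂ + (kA + nNeither) ≡ E + (countTrue A + kA)
      regroup = begin
        countTrue s₁ + countTrue s₂ + (kA + nNeither)   ≡⟨ cong (countTrue s₁ + countTrue s₂ +_) (+-comm kA nNeither) ⟩
        countTrue s₁ + countTrue s₂ + (nNeither + kA)   ≡⟨ +-assoc (countTrue s₁ + countTrue s₂) nNeither kA ⟨
        countTrue s₁ + countTrue s₂ + nNeither + kA     ≡⟨ cong (_+ kA) (countTrue-pieces s₁ s₂) ⟩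
        countTrue A + E + kA                            ≡⟨ cong (_+ kA) (+-comm (countTrue A) E) ⟩
        E + countTrue A + kA                            ≡⟨ +-assoc E (countTrue A) kA ⟩
        E + (countTrue A + kA)                          ∎

    genus-subdivision : (k F' S' + n F' S') ∸ p F' S' ≡ (k F A + n F A) ∸ p F A
    genus-subdivision = begin
      (k F' S' + n F' S') ∸ p F' S'                  ≡⟨ cong₂ (λ k' p' → (k' + n F' S') ∸ p') kS' (SubdivisionBoundaries.p-subdivision F W s₁ s₂) ⟩
      (kA + nNeither + n F' S') ∸ (p F A + nNeither) ≡⟨ cong₂ (λ a b → (a + b) ∸ (p F A + nNeither)) (+-comm kA nNeither) nullity-subdivision ⟩
      (nNeither + kA + n F A) ∸ (p F A + nNeither)   ≡⟨ cong₂ _∸_ (+-assoc nNeither kA (n F A)) (+-comm (p F A) nNeither) ⟩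
      (nNeither + (kA + n F A)) ∸ (nNeither + p F A) ≡⟨ [m+n]∸[m+o]≡n∸o nNeither (kA + n F A) (p F A) ⟩
      (kA + n F A) ∸ p F A                           ∎
      where open ≡-Reasoning

open Combinatorics using (WellFormed; wellFormed; neither; module SubdividedState; module StateExponents; module SubdivisionExponents)

module Expansion {c ℓ : Level} (K : CommutativeRing c ℓ) where
  open import Data.Nat as ℕ using (ℕ; zero; suc)
  open import Data.Bool using (Bool; true; false; _∧_; not)
  open import Data.List using (List; []; _∷_; map; foldr; concatMap; _++_)
  open import Data.Vec as Vec using (Vec; []; _∷_; zipWith; replicate) renaming (_++_ to _++ᵛ_)
  import Relation.Binary.PropositionalEquality as ≡
  open ≡ using (_≡_)
  open CommutativeRing K
  open import Relation.Binary.Reasoning.Setoid setoid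
  open import Algebra.Properties.CommutativeSemigroup *-commutativeSemigroup using (xy∙z≈xz∙y; x∙yz≈y∙xz) renaming (interchange to *-interchange)
  open import Algebra.Properties.CommutativeSemigroup +-commutativeSemigroup using () renaming (interchange to +-interchange)
  open import Algebra.Properties.Semiring.Exp semiring using (_^_; ^-homo-*; ^-congˡ)
  open import Algebra.Properties.CommutativeSemiring.Exp commutativeSemiring using (^-distrib-*)

  pow≡^ : ∀ x m → pow K x m ≡ x ^ m
  pow≡^ x zero    = ≡.refl
  pow≡^ x (suc m) = ≡.cong (x *_) (pow≡^ x m)

  pow-+ : ∀ x a b → pow K x (a ℕ.+ b) ≈ pow K x a * pow K x b
  pow-+ x a b rewrite pow≡^ x (a ℕ.+ b) | pow≡^ x a | pow≡^ x b = ^-homo-* x a b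

  pow-* : ∀ x y a → pow K (x * y) a ≈ pow K x a * pow K y a
  pow-* x y a rewrite pow≡^ (x * y) a | pow≡^ x a | pow≡^ y a = ^-distrib-* x y a

  pow-cong : ∀ {x y} a → x ≈ y → pow K x a ≈ pow K y a
  pow-cong {x} {y} a x≈y rewrite pow≡^ x a | pow≡^ y a = ^-congˡ a x≈y

  pow-1# : ∀ a → pow K 1# a ≈ 1#
  pow-1# zero    = refl
  pow-1# (suc a) = trans (*-identityˡ _) (pow-1# a)

  ∑ : {X : Set} → List X → (X → Carrier) → Carrier
  ∑ L t = foldr _+_ 0# (map t L)

  ∑-cong : {X : Set} (L : List X) {t t' : X → Carrier} → (∀ x → t x ≈ t' x) → ∑ L t ≈ ∑ L t'
  ∑-cong []      eq = refl
  ∑-cong (x ∷ L) eq = +-cong (eq x) (∑-cong L eq)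

  ∑-+ : {X : Set} (L : List X) (t t' : X → Carrier) → ∑ L (λ x → t x + t' x) ≈ ∑ L t + ∑ L t'
  ∑-+ []      t t' = sym (+-identityˡ 0#)
  ∑-+ (x ∷ L) t t' = trans (+-congˡ (∑-+ L t t')) (+-interchange (t x) (t' x) (∑ L t) (∑ L t'))

  *-∑ : {X : Set} (L : List X) (a : Carrier) (t : X → Carrier) → a * ∑ L t ≈ ∑ L (λ x → a * t x)
  *-∑ []      a t = zeroʳ a
  *-∑ (x ∷ L) a t = trans (distribˡ a (t x) (∑ L t)) (+-congˡ (*-∑ L a t))

  ∑-++ : {X : Set} (L M : List X) (t : X → Carrier) → ∑ (L ++ M) t ≈ ∑ L t + ∑ M t
  ∑-++ []      M t = sym (+-identityˡ _)
  ∑-++ (x ∷ L) M t = trans (+-congˡ (∑-++ L M t)) (sym (+-assoc (t x) (∑ L t) (∑ M t)))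

  ∑-allSubsets-suc : ∀ m (t : Vec Bool (suc m) → Carrier) →
                     ∑ (allSubsets (suc m)) t ≈ ∑ (allSubsets m) (λ s → t (false ∷ s) + t (true ∷ s))
  ∑-allSubsets-suc m t = go (allSubsets m)
    where
    go : ∀ L → ∑ (concatMap (λ s → (false ∷ s) ∷ (true ∷ s) ∷ []) L) t ≈ ∑ L (λ s → t (false ∷ s) + t (true ∷ s))
    go []      = refl
    go (s ∷ L) = trans (∑-++ ((false ∷ s) ∷ (true ∷ s) ∷ []) (concatMap (λ s → (false ∷ s) ∷ (true ∷ s) ∷ []) L) t)
                       (+-cong (+-congˡ (+-identityʳ (t (true ∷ s)))) (go L))

  ∑-allSubsets-++ : ∀ m n (t : Vec Bool (m ℕ.+ n) → Carrier) →
    ∑ (allSubsets (m ℕ.+ n)) t ≈ ∑ (allSubsets m) (λ s₁ → ∑ (allSubsets n) (λ s₂ → t (s₁ ++ᵛ s₂)))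
  ∑-allSubsets-++ zero    n t = sym (+-identityʳ _)
  ∑-allSubsets-++ (suc m) n t = begin
    ∑ (allSubsets (suc (m ℕ.+ n))) t                                     ≈⟨ ∑-allSubsets-suc (m ℕ.+ n) t ⟩
    ∑ (allSubsets (m ℕ.+ n)) (λ s → t (false ∷ s) + t (true ∷ s))        ≈⟨ ∑-allSubsets-++ m n _ ⟩
    ∑ (allSubsets m) (λ s₁ → ∑ (allSubsets n) (λ s₂ → t (false ∷ (s₁ ++ᵛ s₂)) + t (true ∷ (s₁ ++ᵛ s₂))))
      ≈⟨ ∑-cong (allSubsets m) (λ s₁ → ∑-+ (allSubsets n) _ _) ⟩
    ∑ (allSubsets m) (λ s₁ → ∑ (allSubsets n) (λ s₂ → t (false ∷ (s₁ ++ᵛ s₂))) + ∑ (allSubsets n) (λ s₂ → t (true ∷ (s₁ ++ᵛ s₂))))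
      ≈⟨ ∑-allSubsets-suc m (λ s₁ → ∑ (allSubsets n) (λ s₂ → t (s₁ ++ᵛ s₂))) ⟨
    ∑ (allSubsets (suc m)) (λ s₁ → ∑ (allSubsets n) (λ s₂ → t (s₁ ++ᵛ s₂))) ∎

  two : Carrier
  two = 1# + 1#

  -- An edge outside A is met by the three pairs (f,f), (f,t), (t,f); only the first adds a factor α.
  edge-outside : ∀ x α P → x * (α * P) + x * P + x * P ≈ x * (α + two) * P
  edge-outside x α P = sym (begin
    x * (α + two) * P                     ≈⟨ *-assoc x (α + two) P ⟩
    x * ((α + two) * P)                   ≈⟨ *-congˡ (distribʳ P α two) ⟩
    x * (α * P + two * P)                 ≈⟨ *-congˡ (+-congˡ (trans (distribʳ P 1# 1#) (+-cong (*-identityˡ P) (*-identityˡ P)))) ⟩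
    x * (α * P + (P + P))                 ≈⟨ distribˡ x (α * P) (P + P) ⟩
    x * (α * P) + x * (P + P)             ≈⟨ +-congˡ (distribˡ x P P) ⟩
    x * (α * P) + (x * P + x * P)         ≈⟨ +-assoc (x * (α * P)) (x * P) (x * P) ⟨
    x * (α * P) + x * P + x * P           ∎)

  ∑-pairs : ∀ E (T : Vec Bool E → Carrier) (α : Carrier) →
    ∑ (allSubsets E) (λ s₁ → ∑ (allSubsets E) (λ s₂ → T (zipWith _∧_ s₁ s₂) * pow K α (countTrue (zipWith neither s₁ s₂))))
      ≈ ∑ (allSubsets E) (λ A → T A * pow K (α + two) (countTrue (Vec.map not A)))
  ∑-pairs zero    T α = +-identityʳ _
  ∑-pairs (suc E) T α = begin
    ∑ (allSubsets (suc E)) (λ s₁ → ∑ (allSubsets (suc E)) (H s₁))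
      ≈⟨ ∑-allSubsets-suc E (λ s₁ → ∑ (allSubsets (suc E)) (H s₁)) ⟩
    ∑ (allSubsets E) (λ s₁ → ∑ (allSubsets (suc E)) (H (false ∷ s₁)) + ∑ (allSubsets (suc E)) (H (true ∷ s₁)))
      ≈⟨ ∑-cong (allSubsets E) (λ s₁ → +-cong (∑-allSubsets-suc E (H (false ∷ s₁))) (∑-allSubsets-suc E (H (true ∷ s₁)))) ⟩
    ∑ (allSubsets E) (λ s₁ → ∑ (allSubsets E) (λ s₂ → H (false ∷ s₁) (false ∷ s₂) + H (false ∷ s₁) (true ∷ s₂))
                           + ∑ (allSubsets E) (λ s₂ → H (true ∷ s₁) (false ∷ s₂) + H (true ∷ s₁) (true ∷ s₂)))
      ≈⟨ ∑-cong (allSubsets E) (λ s₁ → sym (∑-+ (allSubsets E) _ _)) ⟩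
    ∑ (allSubsets E) (λ s₁ → ∑ (allSubsets E) (λ s₂ → (H (false ∷ s₁) (false ∷ s₂) + H (false ∷ s₁) (true ∷ s₂))
                                                   + (H (true ∷ s₁) (false ∷ s₂) + H (true ∷ s₁) (true ∷ s₂))))
      ≈⟨ ∑-cong (allSubsets E) (λ s₁ → ∑-cong (allSubsets E) (λ s₂ → four (zipWith _∧_ s₁ s₂) (pow K α (countTrue (zipWith neither s₁ s₂))))) ⟩
    ∑ (allSubsets E) (λ s₁ → ∑ (allSubsets E) (λ s₂ → T' (zipWith _∧_ s₁ s₂) * pow K α (countTrue (zipWith neither s₁ s₂))))
      ≈⟨ ∑-pairs E T' α ⟩
    ∑ (allSubsets E) (λ A → T' A * pow K t (countTrue (Vec.map not A)))
      ≈⟨ ∑-cong (allSubsets E) (λ A → trans (distribʳ _ _ _) (+-congʳ (*-assoc _ _ _))) ⟩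
    ∑ (allSubsets E) (λ A → T (false ∷ A) * (t * pow K t (countTrue (Vec.map not A))) + T (true ∷ A) * pow K t (countTrue (Vec.map not A)))
      ≈⟨ ∑-allSubsets-suc E (λ A → T A * pow K t (countTrue (Vec.map not A))) ⟨
    ∑ (allSubsets (suc E)) (λ A → T A * pow K t (countTrue (Vec.map not A))) ∎
    where
    t = α + two
    H : Vec Bool (suc E) → Vec Bool (suc E) → Carrier
    H s₁ s₂ = T (zipWith _∧_ s₁ s₂) * pow K α (countTrue (zipWith neither s₁ s₂))
    T' : Vec Bool E → Carrier
    T' A = T (false ∷ A) * t + T (true ∷ A)
    four : ∀ A P → (T (false ∷ A) * (α * P) + T (false ∷ A) * P) + (T (false ∷ A) * P + T (true ∷ A) * P) ≈ T' A * P
    four A P = trans (sym (+-assoc _ _ _)) (trans (+-congʳ (edge-outside (T (false ∷ A)) α P)) (sym (distribʳ P _ _)))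

  weight : (G : RibbonGraph) → Carrier → Carrier → Carrier → State G → Carrier
  weight G a b g A = pow K a (rG G ℕ.∸ r G A) * pow K b (n G A) * pow K g ((k G A ℕ.+ n G A) ℕ.∸ p G A)

  module _ (F : RibbonGraph) (isRG : IsRibbonGraph F) (α β γ : Carrier) where
    private
      W : WellFormed F
      W = wellFormed F isRG
      E : ℕ
      E = ne F
      F' : RibbonGraph
      F' = tensorC3 F

    weight-subdivision : ∀ s₁ s₂ → weight F' α β γ (s₁ ++ᵛ s₂)
                                   ≈ weight F α β γ (zipWith _∧_ s₁ s₂) * pow K α (countTrue (zipWith neither s₁ s₂))
    weight-subdivision s₁ s₂ = begin
      pow K α (rG F' ℕ.∸ r F' S') * pow K β (n F' S') * pow K γ g'
        ≡⟨ ≡.cong₂ (λ x y → pow K α x * pow K β y * pow K γ g') corank-subdivision nullity-subdivision ⟩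
      pow K α (x ℕ.+ a) * pow K β (n F A) * pow K γ g'
        ≡⟨ ≡.cong (λ z → pow K α (x ℕ.+ a) * pow K β (n F A) * pow K γ z) genus-subdivision ⟩
      pow K α (x ℕ.+ a) * pow K β (n F A) * pow K γ g  ≈⟨ *-congʳ (*-congʳ (pow-+ α x a)) ⟩
      pow K α x * pow K α a * pow K β (n F A) * pow K γ g ≈⟨ *-congʳ (xy∙z≈xz∙y (pow K α x) (pow K α a) (pow K β (n F A))) ⟩
      pow K α x * pow K β (n F A) * pow K α a * pow K γ g ≈⟨ xy∙z≈xz∙y (pow K α x * pow K β (n F A)) (pow K α a) (pow K γ g) ⟩
      weight F α β γ A * pow K α a                       ∎
      where
      open SubdividedState F W s₁ s₂
      open SubdivisionExponents F W s₁ s₂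
      x = rG F ℕ.∸ r F A
      a = countTrue (zipWith neither s₁ s₂)
      g = (k F A ℕ.+ n F A) ℕ.∸ p F A
      g' = (k F' S' ℕ.+ n F' S') ℕ.∸ p F' S'

    module _ (δ : Carrier) (δ-inverse : (α + two) * δ ≈ 1#) where
      private
        t : Carrier
        t = α + two

      -- (α t)^x (β δ)^n(A) t^n(F) = α^x β^n(A) t^(n(F) + x − n(A)), and n(F) + x = |E ∖ A| + n(A)
      weight-rescaled : ∀ A → weight F α β γ A * pow K t (countTrue (Vec.map not A)) ≈ pow K t (nG F) * weight F (α * t) (β * δ) γ A
      weight-rescaled A = sym (begin
        pow K t nF * (pow K (α * t) x * pow K (β * δ) nA * pow K γ g)
          ≈⟨ *-congˡ (*-congʳ (*-cong (pow-* α t x) (pow-* β δ nA))) ⟩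
        pow K t nF * ((pow K α x * pow K t x) * (pow K β nA * pow K δ nA) * pow K γ g)
          ≈⟨ *-congˡ (*-congʳ (*-interchange (pow K α x) (pow K t x) (pow K β nA) (pow K δ nA))) ⟩
        pow K t nF * ((pow K α x * pow K β nA) * (pow K t x * pow K δ nA) * pow K γ g)
          ≈⟨ *-congˡ (xy∙z≈xz∙y (pow K α x * pow K β nA) (pow K t x * pow K δ nA) (pow K γ g)) ⟩
        pow K t nF * (weight F α β γ A * (pow K t x * pow K δ nA))
          ≈⟨ x∙yz≈y∙xz (pow K t nF) (weight F α β γ A) (pow K t x * pow K δ nA) ⟩
        weight F α β γ A * (pow K t nF * (pow K t x * pow K δ nA))
          ≈⟨ *-congˡ rescale ⟩
        weight F α β γ A * pow K t nf ∎)
        where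
        open StateExponents F W A using (nullity-shift)
        x = rG F ℕ.∸ r F A
        nA = n F A
        nF = nG F
        g = (k F A ℕ.+ n F A) ℕ.∸ p F A
        nf = countTrue (Vec.map not A)
        rescale : pow K t nF * (pow K t x * pow K δ nA) ≈ pow K t nf
        rescale = begin
          pow K t nF * (pow K t x * pow K δ nA) ≈⟨ *-assoc (pow K t nF) (pow K t x) (pow K δ nA) ⟨
          pow K t nF * pow K t x * pow K δ nA   ≈⟨ *-congʳ (pow-+ t nF x) ⟨
          pow K t (nF ℕ.+ x) * pow K δ nA       ≡⟨ ≡.cong (λ e → pow K t e * pow K δ nA) nullity-shift ⟩
          pow K t (nf ℕ.+ nA) * pow K δ nA      ≈⟨ *-congʳ (pow-+ t nf nA) ⟩
          pow K t nf * pow K t nA * pow K δ nA  ≈⟨ *-assoc (pow K t nf) (pow K t nA) (pow K δ nA) ⟩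
          pow K t nf * (pow K t nA * pow K δ nA) ≈⟨ *-congˡ (pow-* t δ nA) ⟨
          pow K t nf * pow K (t * δ) nA         ≈⟨ *-congˡ (trans (pow-cong nA δ-inverse) (pow-1# nA)) ⟩
          pow K t nf * 1#                       ≈⟨ *-identityʳ (pow K t nf) ⟩
          pow K t nf                            ∎

      BR-subdivision : BR K F' α β γ ≈ pow K t (nG F) * BR K F (α * t) (β * δ) γ
      BR-subdivision = begin
        ∑ (allSubsets (E ℕ.+ E)) (weight F' α β γ)
          ≈⟨ ∑-allSubsets-++ E E (weight F' α β γ) ⟩
        ∑ (allSubsets E) (λ s₁ → ∑ (allSubsets E) (λ s₂ → weight F' α β γ (s₁ ++ᵛ s₂)))
          ≈⟨ ∑-cong (allSubsets E) (λ s₁ → ∑-cong (allSubsets E) (weight-subdivision s₁)) ⟩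
        ∑ (allSubsets E) (λ s₁ → ∑ (allSubsets E) (λ s₂ → weight F α β γ (zipWith _∧_ s₁ s₂) * pow K α (countTrue (zipWith neither s₁ s₂))))
          ≈⟨ ∑-pairs E (weight F α β γ) α ⟩
        ∑ (allSubsets E) (λ A → weight F α β γ A * pow K t (countTrue (Vec.map not A)))
          ≈⟨ ∑-cong (allSubsets E) weight-rescaled ⟩
        ∑ (allSubsets E) (λ A → pow K t (nG F) * weight F (α * t) (β * δ) γ A)
          ≈⟨ *-∑ (allSubsets E) (pow K t (nG F)) (weight F (α * t) (β * δ) γ) ⟨
        pow K t (nG F) * ∑ (allSubsets E) (weight F (α * t) (β * δ) γ) ∎

theorem5p2 : ∀ {c ℓ : Level} (K : CommutativeRing c ℓ) → IsFieldCR K →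
    let open CommutativeRing K in
    (F : RibbonGraph) → IsRibbonGraph F →
    (α β γ δ : Carrier) →
    ¬ (α + (1# + 1#) ≈ 0#) → ¬ (α ≈ 0#) → ¬ (α ≈ 1#) →
    β ≈ α * (1# - α) →
    (γ * γ) * (α * β) ≈ 1# →
    (α + (1# + 1#)) * δ ≈ 1# →
    BR K (tensorC3 F) α β γ
    ≈ pow K (α + (1# + 1#)) (nG F) * BR K F (α * (α + (1# + 1#))) (β * δ) γ
theorem5p2 K _ F isRG α β γ δ _ _ _ _ _ δ-inverse = Expansion.BR-subdivision K F isRG α β γ δ δ-inverse
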